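{- Let $v\equiv 3\pmod 6$ with $v>9$. Then every $\mathrm{STS}(v)$ with a zero-sum $4$-flow can be embedded in an $\mathrm{STS}(2v+1)$ with a zero-sum $4$-flow.
   Context: A Steiner triple system $\mathrm{STS}(v)$ is a pair $(X,\mathcal B)$ where $X$ is a set of $v$ points and $\mathcal B$ is a set of $3$-subsets of $X$ (blocks) such that every $2$-subset of $X$ lies in exactly one block. For a positive integer $n$, a zero-sum $n$-flow of such a system is a map $f:\mathcal B\to\{\pm1,\dots,\pm(n-1)\}$ such that for every point $x$, $\sum_{B\ni x} f(B)=0$. An $\mathrm{STS}(v)$ $(X,\mathcal B)$ is embedded in an $\mathrm{STS}(w)$ $(Y,\mathcal C)$ if $X\subseteq Y$ and $\mathcal B\subseteq\mathcal C$. -}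

module Defs where

open import Data.Nat using (ℕ; _<_)
open import Data.Fin using (Fin; toℕ)
open import Data.Fin.Properties using (_≟_)
open import Data.Integer as ℤ using (ℤ; ∣_∣; 0ℤ)
open import Data.Bool using (Bool; _∨_)
open import Data.List using (List; filter; map; foldr; length)
open import Data.List.Membership.Propositional using (_∈_)
open import Data.Product using (Σ; _×_; ∃)
open import Relation.Nullary using (¬_)
open import Relation.Nullary.Decidable using (⌊_⌋)
open import Relation.Binary.PropositionalEquality using (_≡_)
open import Function.Definitions using (Injective)

-- A 3-subset {a,b,c} of the point set Fin v, stored in increasing order
-- (so each 3-subset has exactly one representation).
record Triple (v : ℕ) : Set where
  constructor triple
  field
    a b c : Fin v
    a<b : toℕ a < toℕ b
    b<c : toℕ b < toℕ c
open Triple public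

hasPt : ∀ {v} → Fin v → Triple v → Bool
hasPt x t = ⌊ x ≟ a t ⌋ ∨ (⌊ x ≟ b t ⌋ ∨ ⌊ x ≟ c t ⌋)

hasPair : ∀ {v} → Fin v → Fin v → Triple v → Bool
hasPair x y t with hasPt x t
... | Bool.true = hasPt y t
... | Bool.false = Bool.false

_∈ᵗ_ : ∀ {v} → Fin v → Triple v → Set
x ∈ᵗ t = hasPt x t ≡ Bool.true

record STS (v : ℕ) : Set where
  constructor sts
  field
    blocks : List (Triple v)
    steiner : ∀ (x y : Fin v) → ¬ (x ≡ y) →
              length (filter (λ t → hasPair x y t Data.Bool.≟ Bool.true) blocks) ≡ 1
open STS public

sumℤ : List ℤ → ℤ
sumℤ = foldr ℤ._+_ 0ℤ

blocksAt : ∀ {v} → STS v → Fin v → List (Triple v)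
blocksAt S x = filter (λ t → hasPt x t Data.Bool.≟ Bool.true) (blocks S)

IsZeroSumFlow : ∀ {v} → ℕ → STS v → (Triple v → ℤ) → Set
IsZeroSumFlow n S f =
  (∀ {t} → t ∈ blocks S → ¬ (f t ≡ 0ℤ) × ∣ f t ∣ < n) ×
  (∀ (x : _) → sumℤ (map f (blocksAt S x)) ≡ 0ℤ)

HasZeroSumFlow : ∀ {v} → ℕ → STS v → Set
HasZeroSumFlow {v} n S = Σ (Triple v → ℤ) (IsZeroSumFlow n S)

EmbeddedIn : ∀ {v w} → STS v → STS w → Set
EmbeddedIn {v} {w} S T =
  Σ (Fin v → Fin w) λ ι → Injective _≡_ _≡_ ι ×
    (∀ {t} → t ∈ blocks S → ∃ λ u → u ∈ blocks T ×
       (ι (a t) ∈ᵗ u × ι (b t) ∈ᵗ u × ι (c t) ∈ᵗ u))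

module Submission where

-- Let v = 2h + 1 and put the old points on ℤ_v; add a copy y′ of ℤ_v and a point ∞.
-- For each old point x the pairs {∞, x′} and {(x + d)′, (x − d)′}, 1 ≤ d ≤ h, form a perfect
-- matching F_x of the new points and ∞, and every pair of these lies in exactly one F_x
-- ({y₁′, y₂′} in F_x for the midpoint x of y₁ and y₂, {y′, ∞} in F_y). So the old blocks together
-- with the blocks {x} ∪ e, e ∈ F_x, form an STS(2v + 1) containing the given STS(v).
--
-- Keep the old flow and give the block B(x, d) = {x} ∪ {(x + d)′, (x − d)′} a value
-- w(x mod 3, d) ∈ {±1, ±2}. The old point x then sees Σ_d w(x, d), the point ∞ sees Σ_x w(x, 0)
-- and the new point y′ sees w(y, 0) + Σ_{d ≥ 1} (w(y − d, d) + w(y + d, d)). As 3 ∣ v, the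
-- residues of y − d and y + d mod 3 are those of y + 2d and y + d, and the table in Labels makes
-- all three sums vanish whenever h ≡ 1 (mod 3) and h ≥ 4, that is v ≡ 3 (mod 6) and v ≥ 9.

open import Defs
open import Algebra.Structures using (IsCommutativeMonoid)
open import Data.Bool as Bool using (Bool; true; false; _∧_; _∨_; if_then_else_)
open import Data.Empty using (⊥-elim)
open import Data.Fin as Fin using (Fin; toℕ; fromℕ<)
import Data.Fin.Properties as Fin
open import Data.Integer as ℤ using (ℤ; 0ℤ)
import Data.Integer.Properties as ℤ-Props
open import Data.List using (List; []; _∷_; _++_; map; filter; foldr; length; concat; applyDownFrom)
open import Data.List.Membership.Propositional using (_∈_)
open import Data.List.Membership.Propositional.Properties
  using (∈-++⁺ˡ; ∈-++⁻; ∈-map⁺; ∈-map⁻; ∈-concat⁻′; ∈-applyDownFrom⁻)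
open import Data.Nat using (ℕ; zero; suc; _<_; _≤_; _+_; _*_; _%_; _/_; _∸_; s≤s; z≤n)
open import Data.Nat.DivMod
  using (m≡m%n+[m/n]*n; m%n<n; m%n%n≡m%n; m<n⇒m%n≡m; [m+n]%n≡m%n; [m+kn]%n≡m%n;
         %-distribˡ-+; %-distribˡ-*; %-remove-+ˡ; %-remove-+ʳ; m∣n⇒o%n%m≡o%m)
open import Data.Nat.Divisibility using (_∣_; ∣-refl; divides)
open import Data.Nat.Properties as ℕ using (_≟_; _≤?_)
open import Data.Nat.Tactic.RingSolver using (solve-∀)
open import Data.Product using (Σ; ∃; _×_; _,_; map₁) renaming (swap to ×-swap)
open import Data.Product.Function.NonDependent.Propositional using (_×-⇔_)
open import Data.Sum using (_⊎_; inj₁; inj₂; [_,_]′; map₂) renaming (swap to ⊎-swap)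
open import Function using (_∘_; const)
open import Function.Bundles using (_⇔_; mk⇔; Equivalence)
open import Function.Definitions using (Injective)
open import Function.Properties.Equivalence using () renaming (refl to ⇔-refl; trans to ⇔-trans)
open import Level using (0ℓ)
open import Relation.Binary.Bundles using (Setoid)
open import Relation.Binary.Definitions using (tri<; tri≈; tri>)
open import Relation.Binary.PropositionalEquality
import Relation.Binary.Reasoning.Setoid as SetoidReasoning
open import Relation.Nullary using (¬_; Dec; yes; no; does)
open import Relation.Nullary.Decidable
  using (⌊_⌋; isYes≗does; dec-true; dec-false; dec-yes-irr; dec-no; does-⇔; _⊎-dec_; _×-dec_)

-- Finite sums in a commutative monoid

module Sums {A : Set} {_+ᴬ_ : A → A → A} {0# : A}
            (isCM : IsCommutativeMonoid _≡_ _+ᴬ_ 0#) where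

  open IsCommutativeMonoid isCM using (assoc; comm; identityˡ; identityʳ)
  open ≡-Reasoning

  Σ< : ℕ → (ℕ → A) → A
  Σ< zero    f = 0#
  Σ< (suc n) f = f n +ᴬ Σ< n f

  infixr 25 [_]·_
  [_]·_ : Bool → A → A
  [ b ]· z = if b then z else 0#

  Σ<-cong : ∀ n {f g : ℕ → A} → (∀ i → i < n → f i ≡ g i) → Σ< n f ≡ Σ< n g
  Σ<-cong zero    f≗g = refl
  Σ<-cong (suc n) f≗g =
    cong₂ _+ᴬ_ (f≗g n (ℕ.n<1+n n)) (Σ<-cong n (λ i i<n → f≗g i (ℕ.m<n⇒m<1+n i<n)))

  Σ<-zero : ∀ n {f : ℕ → A} → (∀ i → i < n → f i ≡ 0#) → Σ< n f ≡ 0#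
  Σ<-zero zero    f≗0 = refl
  Σ<-zero (suc n) {f} f≗0 = begin
    f n +ᴬ Σ< n f
      ≡⟨ cong₂ _+ᴬ_ (f≗0 n (ℕ.n<1+n n)) (Σ<-zero n (λ i i<n → f≗0 i (ℕ.m<n⇒m<1+n i<n))) ⟩
    0# +ᴬ 0#
      ≡⟨ identityˡ 0# ⟩
    0# ∎

  +-interchange : ∀ a b c d → (a +ᴬ b) +ᴬ (c +ᴬ d) ≡ (a +ᴬ c) +ᴬ (b +ᴬ d)
  +-interchange a b c d = begin
    (a +ᴬ b) +ᴬ (c +ᴬ d) ≡⟨ assoc a b _ ⟩
    a +ᴬ (b +ᴬ (c +ᴬ d)) ≡⟨ cong (a +ᴬ_) (sym (assoc b c d)) ⟩
    a +ᴬ ((b +ᴬ c) +ᴬ d) ≡⟨ cong (λ z → a +ᴬ (z +ᴬ d)) (comm b c) ⟩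
    a +ᴬ ((c +ᴬ b) +ᴬ d) ≡⟨ cong (a +ᴬ_) (assoc c b d) ⟩
    a +ᴬ (c +ᴬ (b +ᴬ d)) ≡⟨ sym (assoc a c _) ⟩
    (a +ᴬ c) +ᴬ (b +ᴬ d) ∎

  Σ<-distrib : ∀ n (f g : ℕ → A) → Σ< n (λ i → f i +ᴬ g i) ≡ Σ< n f +ᴬ Σ< n g
  Σ<-distrib zero    f g = sym (identityˡ 0#)
  Σ<-distrib (suc n) f g =
    trans (cong ((f n +ᴬ g n) +ᴬ_) (Σ<-distrib n f g)) (+-interchange (f n) (g n) _ _)

  Σ<-swap : ∀ n m (F : ℕ → ℕ → A) →
            Σ< n (λ i → Σ< m (F i)) ≡ Σ< m (λ j → Σ< n (λ i → F i j))
  Σ<-swap zero    m F = sym (Σ<-zero m (λ _ _ → refl))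
  Σ<-swap (suc n) m F =
    trans (cong (Σ< m (F n) +ᴬ_) (Σ<-swap n m F)) (sym (Σ<-distrib m (F n) _))

  Σ<-split : ∀ k n (F : ℕ → A) → Σ< (k + n) F ≡ Σ< n (λ j → F (k + j)) +ᴬ Σ< k F
  Σ<-split k zero    F rewrite ℕ.+-identityʳ k = sym (identityˡ _)
  Σ<-split k (suc n) F rewrite ℕ.+-suc k n | Σ<-split k n F = sym (assoc (F (k + n)) _ _)

  Σ<-periodic : ∀ p m (F : ℕ → A) → (∀ j → F (p + j) ≡ F j) → Σ< p F ≡ 0# →
                Σ< (m * p) F ≡ 0#
  Σ<-periodic p zero    F period zero-sum = refl
  Σ<-periodic p (suc m) F period zero-sum = begin
    Σ< (p + m * p) F                       ≡⟨ Σ<-split p (m * p) F ⟩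
    Σ< (m * p) (λ j → F (p + j)) +ᴬ Σ< p F ≡⟨ cong₂ _+ᴬ_ shifted zero-sum ⟩
    0# +ᴬ 0#                               ≡⟨ identityˡ 0# ⟩
    0# ∎
    where
    shifted : Σ< (m * p) (λ j → F (p + j)) ≡ 0#
    shifted = trans (Σ<-cong (m * p) (λ j _ → period j)) (Σ<-periodic p m F period zero-sum)

  Σ<-[]· : ∀ n b (f : ℕ → A) → Σ< n (λ i → [ b ]· f i) ≡ [ b ]· Σ< n f
  Σ<-[]· n true  f = refl
  Σ<-[]· n false f = Σ<-zero n (λ _ _ → refl)

  Σ<-delta : ∀ n {a} (f : ℕ → A) → a < n → Σ< n (λ i → [ does (i ≟ a) ]· f i) ≡ f a
  Σ<-delta (suc n) {a} f a<1+n with n ≟ a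
  ... | yes refl = begin
    [ does (n ≟ n) ]· f n +ᴬ Σ< n (λ i → [ does (i ≟ n) ]· f i)
      ≡⟨ cong₂ _+ᴬ_ (cong ([_]· f n) (dec-true (n ≟ n) refl))
                    (Σ<-zero n (λ i i<n → cong ([_]· f i) (dec-false (i ≟ n) (ℕ.<⇒≢ i<n)))) ⟩
    f n +ᴬ 0# ≡⟨ identityʳ (f n) ⟩
    f n ∎
  ... | no n≢a = begin
    [ does (n ≟ a) ]· f n +ᴬ Σ< n (λ i → [ does (i ≟ a) ]· f i)
      ≡⟨ cong (λ b → [ b ]· f n +ᴬ Σ< n (λ i → [ does (i ≟ a) ]· f i)) (dec-false (n ≟ a) n≢a) ⟩
    0# +ᴬ Σ< n (λ i → [ does (i ≟ a) ]· f i)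
      ≡⟨ identityˡ _ ⟩
    Σ< n (λ i → [ does (i ≟ a) ]· f i)
      ≡⟨ Σ<-delta n f (ℕ.≤∧≢⇒< (ℕ.≤-pred a<1+n) (n≢a ∘ sym)) ⟩
    f a ∎

  []·-∧ : ∀ b₁ b₂ z → [ b₁ ∧ b₂ ]· z ≡ [ b₁ ]· [ b₂ ]· z
  []·-∧ true  b₂ z = refl
  []·-∧ false b₂ z = refl

  Σ<-delta₂ : ∀ n m {a b} (f : ℕ → ℕ → A) → a < n → b < m →
              Σ< n (λ i → Σ< m (λ j → [ does (i ≟ a) ∧ does (j ≟ b) ]· f i j)) ≡ f a b
  Σ<-delta₂ n m {a} {b} f a<n b<m = begin
    Σ< n (λ i → Σ< m (λ j → [ does (i ≟ a) ∧ does (j ≟ b) ]· f i j))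
      ≡⟨ Σ<-cong n (λ i _ → trans (Σ<-cong m (λ j _ → []·-∧ (does (i ≟ a)) (does (j ≟ b)) (f i j)))
                                  (Σ<-[]· m (does (i ≟ a)) (λ j → [ does (j ≟ b) ]· f i j))) ⟩
    Σ< n (λ i → [ does (i ≟ a) ]· Σ< m (λ j → [ does (j ≟ b) ]· f i j))
      ≡⟨ Σ<-delta n (λ i → Σ< m (λ j → [ does (j ≟ b) ]· f i j)) a<n ⟩
    Σ< m (λ j → [ does (j ≟ b) ]· f a j)
      ≡⟨ Σ<-delta m (f a) b<m ⟩
    f a b ∎

  []·-⊎ : ∀ {P Q R : Set} (P? : Dec P) (Q? : Dec Q) (R? : Dec R) →
          P ⇔ (Q ⊎ R) → ¬ (Q × R) → ∀ z → [ does P? ]· z ≡ [ does Q? ]· z +ᴬ [ does R? ]· z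
  []·-⊎ P? (yes q) (yes r) P⇔Q⊎R ¬Q×R z = ⊥-elim (¬Q×R (q , r))
  []·-⊎ P? (yes q) (no ¬r) P⇔Q⊎R ¬Q×R z =
    trans (cong ([_]· z) (dec-true P? (Equivalence.from P⇔Q⊎R (inj₁ q)))) (sym (identityʳ z))
  []·-⊎ P? (no ¬q) (yes r) P⇔Q⊎R ¬Q×R z =
    trans (cong ([_]· z) (dec-true P? (Equivalence.from P⇔Q⊎R (inj₂ r)))) (sym (identityˡ z))
  []·-⊎ P? (no ¬q) (no ¬r) P⇔Q⊎R ¬Q×R z =
    trans (cong ([_]· z) (dec-false P? ([ ¬q , ¬r ]′ ∘ Equivalence.to P⇔Q⊎R))) (sym (identityˡ 0#))

  sumWhere : {X : Set} → (X → Bool) → (X → A) → List X → A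
  sumWhere p f xs = foldr _+ᴬ_ 0# (map f (filter (λ t → p t Bool.≟ true) xs))

  sumWhere-∷ : ∀ {X : Set} (p : X → Bool) f t xs →
               sumWhere p f (t ∷ xs) ≡ [ p t ]· f t +ᴬ sumWhere p f xs
  sumWhere-∷ p f t xs with p t
  ... | true  = refl
  ... | false = sym (identityˡ _)

  sumWhere-++ : ∀ {X : Set} (p : X → Bool) f xs ys →
                sumWhere p f (xs ++ ys) ≡ sumWhere p f xs +ᴬ sumWhere p f ys
  sumWhere-++ p f []       ys = sym (identityˡ _)
  sumWhere-++ p f (t ∷ xs) ys = begin
    sumWhere p f (t ∷ xs ++ ys)
      ≡⟨ sumWhere-∷ p f t (xs ++ ys) ⟩
    [ p t ]· f t +ᴬ sumWhere p f (xs ++ ys)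
      ≡⟨ cong ([ p t ]· f t +ᴬ_) (sumWhere-++ p f xs ys) ⟩
    [ p t ]· f t +ᴬ (sumWhere p f xs +ᴬ sumWhere p f ys)
      ≡⟨ sym (assoc _ _ _) ⟩
    ([ p t ]· f t +ᴬ sumWhere p f xs) +ᴬ sumWhere p f ys
      ≡⟨ cong (_+ᴬ sumWhere p f ys) (sym (sumWhere-∷ p f t xs)) ⟩
    sumWhere p f (t ∷ xs) +ᴬ sumWhere p f ys ∎

  sumWhere-map : ∀ {X Y : Set} (p : Y → Bool) f (g : X → Y) xs →
                 sumWhere p f (map g xs) ≡ sumWhere (p ∘ g) (f ∘ g) xs
  sumWhere-map p f g []       = refl
  sumWhere-map p f g (t ∷ xs) rewrite sumWhere-∷ p f (g t) (map g xs)
    | sumWhere-∷ (p ∘ g) (f ∘ g) t xs | sumWhere-map p f g xs = refl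

  sumWhere-cong : ∀ {X : Set} {p q : X → Bool} {f g : X → A} xs →
                  (∀ t → p t ≡ q t) → (∀ t → f t ≡ g t) → sumWhere p f xs ≡ sumWhere q g xs
  sumWhere-cong {p = p} {q} {f} {g} []       p≗q f≗g = refl
  sumWhere-cong {p = p} {q} {f} {g} (t ∷ xs) p≗q f≗g rewrite sumWhere-∷ p f t xs
    | sumWhere-∷ q g t xs | p≗q t | f≗g t | sumWhere-cong xs p≗q f≗g = refl

  sumWhere-none : ∀ {X : Set} (p : X → Bool) f xs → (∀ t → p t ≡ false) → sumWhere p f xs ≡ 0#
  sumWhere-none p f []       p≗false = refl
  sumWhere-none p f (t ∷ xs) p≗false rewrite sumWhere-∷ p f t xs | p≗false t =
    trans (identityˡ _) (sumWhere-none p f xs p≗false)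

  sumWhere-applyDownFrom : ∀ {X : Set} (p : X → Bool) f (g : ℕ → X) n →
    sumWhere p f (applyDownFrom g n) ≡ Σ< n (λ i → [ p (g i) ]· f (g i))
  sumWhere-applyDownFrom p f g zero    = refl
  sumWhere-applyDownFrom p f g (suc n) =
    trans (sumWhere-∷ p f (g n) _) (cong (_ +ᴬ_) (sumWhere-applyDownFrom p f g n))

  sumWhere-grid : ∀ {X : Set} (p : X → Bool) f (g : ℕ → ℕ → X) n m →
    sumWhere p f (concat (applyDownFrom (λ x → applyDownFrom (g x) m) n))
      ≡ Σ< n (λ x → Σ< m (λ d → [ p (g x d) ]· f (g x d)))
  sumWhere-grid p f g zero    m = refl
  sumWhere-grid p f g (suc n) m =
    trans (sumWhere-++ p f (applyDownFrom (g n) m) _)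
      (cong₂ _+ᴬ_ (sumWhere-applyDownFrom p f (g n) m) (sumWhere-grid p f g n m))

module Σℕ = Sums ℕ.+-0-isCommutativeMonoid
module Σℤ = Sums ℤ-Props.+-0-isCommutativeMonoid

count≡sumWhere : ∀ {X : Set} (p : X → Bool) xs →
                 length (filter (λ t → p t Bool.≟ true) xs) ≡ Σℕ.sumWhere p (const 1) xs
count≡sumWhere p xs = length≡Σ1 (filter (λ t → p t Bool.≟ true) xs)
  where
  length≡Σ1 : ∀ {X : Set} (ys : List X) → length ys ≡ foldr _+_ 0 (map (const 1) ys)
  length≡Σ1 []       = refl
  length≡Σ1 (_ ∷ ys) = cong suc (length≡Σ1 ys)

-- Blocks as sets of natural numbers

module _ {n : ℕ} where

  infix 4 _∈ᴺ_ _∈ᴺ?_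
  _∈ᴺ_ : ℕ → Triple n → Set
  k ∈ᴺ t = k ≡ toℕ (a t) ⊎ k ≡ toℕ (b t) ⊎ k ≡ toℕ (c t)

  _∈ᴺ?_ : ∀ k t → Dec (k ∈ᴺ t)
  k ∈ᴺ? t = k ≟ toℕ (a t) ⊎-dec k ≟ toℕ (b t) ⊎-dec k ≟ toℕ (c t)

  bothIn : ℕ → ℕ → Triple n → Bool
  bothIn k₁ k₂ t = does (k₁ ∈ᴺ? t ×-dec k₂ ∈ᴺ? t)

  pairCount : ℕ → ℕ → List (Triple n) → ℕ
  pairCount k₁ k₂ = Σℕ.sumWhere (bothIn k₁ k₂) (const 1)

  sumAt : ℕ → (Triple n → ℤ) → List (Triple n) → ℤ
  sumAt k = Σℤ.sumWhere (λ t → does (k ∈ᴺ? t))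

  ⌊≟⌋-toℕ : ∀ (u v : Fin n) → ⌊ u Fin.≟ v ⌋ ≡ does (toℕ u ≟ toℕ v)
  ⌊≟⌋-toℕ u v = trans (isYes≗does (u Fin.≟ v))
    (does-⇔ (mk⇔ (cong toℕ) Fin.toℕ-injective) (u Fin.≟ v) (toℕ u ≟ toℕ v))

  hasPt-∈ᴺ : ∀ (u : Fin n) t → hasPt u t ≡ does (toℕ u ∈ᴺ? t)
  hasPt-∈ᴺ u t =
    cong₂ _∨_ (⌊≟⌋-toℕ u (a t)) (cong₂ _∨_ (⌊≟⌋-toℕ u (b t)) (⌊≟⌋-toℕ u (c t)))

  hasPair-∈ᴺ : ∀ (u w : Fin n) t → hasPair u w t ≡ bothIn (toℕ u) (toℕ w) t
  hasPair-∈ᴺ u w t with hasPt u t | hasPt-∈ᴺ u t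
  ... | true  | u∈t = cong₂ _∧_ u∈t (hasPt-∈ᴺ w t)
  ... | false | u∈t = cong (_∧ does (toℕ w ∈ᴺ? t)) u∈t

  count-hasPair : ∀ (u w : Fin n) xs →
                  length (filter (λ t → hasPair u w t Bool.≟ true) xs) ≡ pairCount (toℕ u) (toℕ w) xs
  count-hasPair u w xs =
    trans (count≡sumWhere (hasPair u w) xs) (Σℕ.sumWhere-cong xs (hasPair-∈ᴺ u w) (λ _ → refl))

  sum-hasPt : ∀ (u : Fin n) f xs → Σℤ.sumWhere (hasPt u) f xs ≡ sumAt (toℕ u) f xs
  sum-hasPt u f xs = Σℤ.sumWhere-cong xs (hasPt-∈ᴺ u) (λ _ → refl)

  ∈ᴺ⇒< : ∀ {k} (t : Triple n) → k ∈ᴺ t → k < n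
  ∈ᴺ⇒< t (inj₁ refl)        = Fin.toℕ<n (a t)
  ∈ᴺ⇒< t (inj₂ (inj₁ refl)) = Fin.toℕ<n (b t)
  ∈ᴺ⇒< t (inj₂ (inj₂ refl)) = Fin.toℕ<n (c t)

  Triple-≡ : ∀ {t u : Triple n} → a t ≡ a u → b t ≡ b u → c t ≡ c u → t ≡ u
  Triple-≡ {triple x y z _ _} {triple .x .y .z _ _} refl refl refl =
    cong₂ (triple x y z) (ℕ.<-irrelevant _ _) (ℕ.<-irrelevant _ _)

  opaque
    ⟨_,_,_⟩ : (i j k : ℕ) → i < j → j < k → k < n → Triple n
    ⟨ i , j , k ⟩ i<j j<k k<n = triple (fromℕ< i<n) (fromℕ< j<n) (fromℕ< k<n)
      (subst₂ _<_ (sym (Fin.toℕ-fromℕ< i<n)) (sym (Fin.toℕ-fromℕ< j<n)) i<j)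
      (subst₂ _<_ (sym (Fin.toℕ-fromℕ< j<n)) (sym (Fin.toℕ-fromℕ< k<n)) j<k)
      where
      j<n : j < n
      j<n = ℕ.<-trans j<k k<n
      i<n : i < n
      i<n = ℕ.<-trans i<j j<n

    a-⟨⟩ : ∀ {i j k} i<j j<k k<n → toℕ (a (⟨ i , j , k ⟩ i<j j<k k<n)) ≡ i
    a-⟨⟩ _ _ _ = Fin.toℕ-fromℕ< _

    b-⟨⟩ : ∀ {i j k} i<j j<k k<n → toℕ (b (⟨ i , j , k ⟩ i<j j<k k<n)) ≡ j
    b-⟨⟩ _ _ _ = Fin.toℕ-fromℕ< _

    c-⟨⟩ : ∀ {i j k} i<j j<k k<n → toℕ (c (⟨ i , j , k ⟩ i<j j<k k<n)) ≡ k
    c-⟨⟩ _ _ _ = Fin.toℕ-fromℕ< _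

  ∈ᴺ-⟨⟩ : ∀ {m i j k} i<j j<k k<n → m ∈ᴺ ⟨ i , j , k ⟩ i<j j<k k<n ⇔ (m ≡ i ⊎ m ≡ j ⊎ m ≡ k)
  ∈ᴺ-⟨⟩ {m} i<j j<k k<n
    rewrite a-⟨⟩ i<j j<k k<n | b-⟨⟩ i<j j<k k<n | c-⟨⟩ i<j j<k k<n = ⇔-refl

  block : (i j k : ℕ) → i < j → i < k → j ≢ k → j < n → k < n → Triple n
  block i j k i<j i<k j≢k j<n k<n with ℕ.<-cmp j k
  ... | tri< j<k _ _ = ⟨ i , j , k ⟩ i<j j<k k<n
  ... | tri≈ _ j≡k _ = ⊥-elim (j≢k j≡k)
  ... | tri> _ _ k<j = ⟨ i , k , j ⟩ i<k k<j j<n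

  ∈ᴺ-block : ∀ {m i j k} i<j i<k j≢k j<n k<n →
             m ∈ᴺ block i j k i<j i<k j≢k j<n k<n ⇔ (m ≡ i ⊎ m ≡ j ⊎ m ≡ k)
  ∈ᴺ-block {m} {i} {j} {k} i<j i<k j≢k j<n k<n with ℕ.<-cmp j k
  ... | tri< j<k _ _ = ∈ᴺ-⟨⟩ i<j j<k k<n
  ... | tri≈ _ j≡k _ = ⊥-elim (j≢k j≡k)
  ... | tri> _ _ k<j = mk⇔ (map₂ ⊎-swap ∘ Equivalence.to (∈ᴺ-⟨⟩ i<k k<j j<n))
                           (Equivalence.from (∈ᴺ-⟨⟩ i<k k<j j<n) ∘ map₂ ⊎-swap)

  a-block : ∀ {i j k} i<j i<k j≢k j<n k<n → toℕ (a (block i j k i<j i<k j≢k j<n k<n)) ≡ i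
  a-block {i} {j} {k} i<j i<k j≢k j<n k<n with ℕ.<-cmp j k
  ... | tri< j<k _ _ = a-⟨⟩ i<j j<k k<n
  ... | tri≈ _ j≡k _ = ⊥-elim (j≢k j≡k)
  ... | tri> _ _ k<j = a-⟨⟩ i<k k<j j<n

-- Arithmetic modulo V = 2h + 1

module Cyclic (h : ℕ) where

  V : ℕ
  V = suc (h + h)

  h<V : h < V
  h<V = s≤s (ℕ.m≤m+n h h)

  ≤h⇒<V : ∀ {d} → d ≤ h → d < V
  ≤h⇒<V d≤h = ℕ.≤-trans (s≤s d≤h) h<V

  infix 4 _≈_
  record _≈_ (a b : ℕ) : Set where
    constructor mod-≡
    field %-≡ : a % V ≡ b % V

  ≈-setoid : Setoid 0ℓ 0ℓ
  ≈-setoid = record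
    { Carrier       = ℕ
    ; _≈_           = _≈_
    ; isEquivalence = record
      { refl  = mod-≡ refl
      ; sym   = λ (mod-≡ p) → mod-≡ (sym p)
      ; trans = λ (mod-≡ p) (mod-≡ q) → mod-≡ (trans p q)
      }
    }

  open Setoid ≈-setoid public using () renaming (refl to ≈-refl; sym to ≈-sym; trans to ≈-trans)
  module ≈-Reasoning = SetoidReasoning ≈-setoid

  ≡⇒≈ : ∀ {a b} → a ≡ b → a ≈ b
  ≡⇒≈ refl = ≈-refl

  +-cong : ∀ {a b c d} → a ≈ b → c ≈ d → a + c ≈ b + d
  +-cong {a} {b} {c} {d} (mod-≡ p) (mod-≡ q) = mod-≡ (begin
    (a + c) % V         ≡⟨ %-distribˡ-+ a c V ⟩
    (a % V + c % V) % V ≡⟨ cong₂ (λ x y → (x + y) % V) p q ⟩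
    (b % V + d % V) % V ≡⟨ %-distribˡ-+ b d V ⟨
    (b + d) % V         ∎)
    where open ≡-Reasoning

  *-cong : ∀ {a b c d} → a ≈ b → c ≈ d → a * c ≈ b * d
  *-cong {a} {b} {c} {d} (mod-≡ p) (mod-≡ q) = mod-≡ (begin
    (a * c) % V         ≡⟨ %-distribˡ-* a c V ⟩
    (a % V * (c % V)) % V ≡⟨ cong₂ (λ x y → (x * y) % V) p q ⟩
    (b % V * (d % V)) % V ≡⟨ %-distribˡ-* b d V ⟨
    (b * d) % V         ∎)
    where open ≡-Reasoning

  %-≈ : ∀ a → a % V ≈ a
  %-≈ a = mod-≡ (m%n%n≡m%n a V)

  +V-≈ : ∀ a → a + V ≈ a
  +V-≈ a = mod-≡ ([m+n]%n≡m%n a V)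

  +*V-≈ : ∀ a k → a + k * V ≈ a
  +*V-≈ a k = mod-≡ ([m+kn]%n≡m%n a k V)

  ≈⇒≡ : ∀ {a b} → a < V → b < V → a ≈ b → a ≡ b
  ≈⇒≡ a<V b<V (mod-≡ e) = trans (sym (m<n⇒m%n≡m a<V)) (trans e (m<n⇒m%n≡m b<V))

  -- c * (h + h) is an additive inverse of c modulo V.
  +-cancelʳ-≈ : ∀ {a b} c → a + c ≈ b + c → a ≈ b
  +-cancelʳ-≈ {a} {b} c a+c≈b+c = begin
    a                   ≈⟨ +*V-≈ a c ⟨
    a + c * V           ≡⟨ add-inverse a c h ⟨
    a + c + c * (h + h) ≈⟨ +-cong a+c≈b+c ≈-refl ⟩
    b + c + c * (h + h) ≡⟨ add-inverse b c h ⟩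
    b + c * V           ≈⟨ +*V-≈ b c ⟩
    b                   ∎
    where
    open ≈-Reasoning
    add-inverse : ∀ x c h → x + c + c * (h + h) ≡ x + c * suc (h + h)
    add-inverse = solve-∀

  +-cancelˡ-≈ : ∀ {a b} c → c + a ≈ c + b → a ≈ b
  +-cancelˡ-≈ {a} {b} c c+a≈c+b =
    +-cancelʳ-≈ c (≈-trans (≡⇒≈ (ℕ.+-comm a c)) (≈-trans c+a≈c+b (≡⇒≈ (ℕ.+-comm c b))))

  -- suc h is the inverse of 2 modulo V.
  double-injective : ∀ {a b} → a + a ≈ b + b → a ≈ b
  double-injective {a} {b} 2a≈2b = begin
    a                   ≈⟨ +*V-≈ a a ⟨
    a + a * V           ≡⟨ halve a h ⟨
    (a + a) * suc h     ≈⟨ *-cong 2a≈2b ≈-refl ⟩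
    (b + b) * suc h     ≡⟨ halve b h ⟩
    b + b * V           ≈⟨ +*V-≈ b b ⟩
    b                   ∎
    where
    open ≈-Reasoning
    halve : ∀ x h → (x + x) * suc h ≡ x + x * suc (h + h)
    halve = solve-∀

  infixl 6 _⊕_ _⊖_
  _⊕_ _⊖_ : ℕ → ℕ → ℕ
  x ⊕ d = (x + d) % V
  x ⊖ d = x ⊕ (V ∸ d)

  ⊕<V : ∀ x d → x ⊕ d < V
  ⊕<V x d = m%n<n (x + d) V

  ⊕-≈ : ∀ x d → x ⊕ d ≈ x + d
  ⊕-≈ x d = %-≈ (x + d)

  ⊕-identityʳ : ∀ {x} → x < V → x ⊕ 0 ≡ x
  ⊕-identityʳ {x} x<V = trans (cong (_% V) (ℕ.+-identityʳ x)) (m<n⇒m%n≡m x<V)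

  ⊖-identityʳ : ∀ {x} → x < V → x ⊖ 0 ≡ x
  ⊖-identityʳ {x} x<V = ≈⇒≡ (⊕<V x V) x<V (≈-trans (⊕-≈ x V) (+V-≈ x))

  x⊖x≡0 : ∀ {x} → x < V → x ⊖ x ≡ 0
  x⊖x≡0 {x} x<V = ≈⇒≡ (⊕<V x (V ∸ x)) (s≤s z≤n) (begin
    x ⊖ x       ≈⟨ ⊕-≈ x (V ∸ x) ⟩
    x + (V ∸ x) ≡⟨ ℕ.m+[n∸m]≡n (ℕ.<⇒≤ x<V) ⟩
    V           ≈⟨ +V-≈ 0 ⟩
    0           ∎)
    where open ≈-Reasoning

  [x⊕d]⊖x≡d : ∀ {x d} → x < V → d < V → x ⊕ d ⊖ x ≡ d
  [x⊕d]⊖x≡d {x} {d} x<V d<V = ≈⇒≡ (⊕<V (x ⊕ d) (V ∸ x)) d<V (begin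
    x ⊕ d ⊖ x           ≈⟨ ⊕-≈ (x ⊕ d) (V ∸ x) ⟩
    x ⊕ d + (V ∸ x)     ≈⟨ +-cong (⊕-≈ x d) ≈-refl ⟩
    x + d + (V ∸ x)     ≡⟨ rearrange x d (V ∸ x) ⟩
    d + (x + (V ∸ x))   ≡⟨ cong (d +_) (ℕ.m+[n∸m]≡n (ℕ.<⇒≤ x<V)) ⟩
    d + V               ≈⟨ +V-≈ d ⟩
    d                   ∎)
    where
    open ≈-Reasoning
    rearrange : ∀ x d w → x + d + w ≡ d + (x + w)
    rearrange = solve-∀

  x⊕[y⊖x]≡y : ∀ {x y} → x < V → y < V → x ⊕ (y ⊖ x) ≡ y
  x⊕[y⊖x]≡y {x} {y} x<V y<V = ≈⇒≡ (⊕<V x (y ⊖ x)) y<V (begin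
    x ⊕ (y ⊖ x)         ≈⟨ ⊕-≈ x (y ⊖ x) ⟩
    x + (y ⊖ x)         ≈⟨ +-cong (≈-refl {x}) (⊕-≈ y (V ∸ x)) ⟩
    x + (y + (V ∸ x))   ≡⟨ rearrange x y (V ∸ x) ⟩
    y + (x + (V ∸ x))   ≡⟨ cong (y +_) (ℕ.m+[n∸m]≡n (ℕ.<⇒≤ x<V)) ⟩
    y + V               ≈⟨ +V-≈ y ⟩
    y                   ∎)
    where
    open ≈-Reasoning
    rearrange : ∀ x y w → x + (y + w) ≡ y + (x + w)
    rearrange = solve-∀

  [x⊕d]⊖d≡x : ∀ {x d} → x < V → d ≤ V → x ⊕ d ⊖ d ≡ x
  [x⊕d]⊖d≡x {x} {d} x<V d≤V = ≈⇒≡ (⊕<V (x ⊕ d) (V ∸ d)) x<V (begin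
    x ⊕ d ⊖ d           ≈⟨ ⊕-≈ (x ⊕ d) (V ∸ d) ⟩
    x ⊕ d + (V ∸ d)     ≈⟨ +-cong (⊕-≈ x d) ≈-refl ⟩
    x + d + (V ∸ d)     ≡⟨ ℕ.+-assoc x d (V ∸ d) ⟩
    x + (d + (V ∸ d))   ≡⟨ cong (x +_) (ℕ.m+[n∸m]≡n d≤V) ⟩
    x + V               ≈⟨ +V-≈ x ⟩
    x                   ∎)
    where open ≈-Reasoning

  [x⊖d]⊕d≡x : ∀ {x d} → x < V → d ≤ V → x ⊖ d ⊕ d ≡ x
  [x⊖d]⊕d≡x {x} {d} x<V d≤V = ≈⇒≡ (⊕<V (x ⊖ d) d) x<V (begin
    x ⊖ d ⊕ d           ≈⟨ ⊕-≈ (x ⊖ d) d ⟩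
    x ⊖ d + d           ≈⟨ +-cong (⊕-≈ x (V ∸ d)) ≈-refl ⟩
    x + (V ∸ d) + d     ≡⟨ ℕ.+-assoc x (V ∸ d) d ⟩
    x + ((V ∸ d) + d)   ≡⟨ cong (x +_) (ℕ.m∸n+n≡m d≤V) ⟩
    x + V               ≈⟨ +V-≈ x ⟩
    x                   ∎)
    where open ≈-Reasoning

  [x⊕d]+[x⊖d]≈x+x : ∀ x {d} → d ≤ V → x ⊕ d + (x ⊖ d) ≈ x + x
  [x⊕d]+[x⊖d]≈x+x x {d} d≤V = begin
    x ⊕ d + (x ⊖ d)             ≈⟨ +-cong (⊕-≈ x d) (⊕-≈ x (V ∸ d)) ⟩
    x + d + (x + (V ∸ d))       ≡⟨ rearrange x d (V ∸ d) ⟩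
    x + x + ((V ∸ d) + d)       ≡⟨ cong (x + x +_) (ℕ.m∸n+n≡m d≤V) ⟩
    x + x + V                   ≈⟨ +V-≈ (x + x) ⟩
    x + x                       ∎
    where
    open ≈-Reasoning
    rearrange : ∀ x d w → x + d + (x + w) ≡ x + x + (w + d)
    rearrange = solve-∀

  [x⊖d]+[x⊕d]≈x+x : ∀ x {d} → d ≤ V → x ⊖ d + (x ⊕ d) ≈ x + x
  [x⊖d]+[x⊕d]≈x+x x {d} d≤V = ≈-trans (≡⇒≈ (ℕ.+-comm (x ⊖ d) (x ⊕ d))) ([x⊕d]+[x⊖d]≈x+x x d≤V)

  ⊕≢⊖ : ∀ x {d} → 1 ≤ d → d ≤ h → x ⊕ d ≢ x ⊖ d
  ⊕≢⊖ x {d} 1≤d d≤h x⊕d≡x⊖d =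
    ℕ.<⇒≢ 1≤d (sym (≈⇒≡ (≤h⇒<V d≤h) (s≤s z≤n) (double-injective d+d≈0)))
    where
    open ≈-Reasoning
    x+d≈x+[V∸d] : x + d ≈ x + (V ∸ d)
    x+d≈x+[V∸d] = ≈-trans (≈-sym (⊕-≈ x d)) (≈-trans (≡⇒≈ x⊕d≡x⊖d) (⊕-≈ x (V ∸ d)))
    d+d≈0 : d + d ≈ 0 + 0
    d+d≈0 = begin
      d + d               ≈⟨ +-cong {d} (+-cancelˡ-≈ x x+d≈x+[V∸d]) ≈-refl ⟩
      (V ∸ d) + d         ≡⟨ ℕ.m∸n+n≡m (ℕ.<⇒≤ (≤h⇒<V d≤h)) ⟩
      V                   ≈⟨ +V-≈ 0 ⟩
      0                   ∎

  ⊕≡⊖⇒≡0 : ∀ {x d} → d ≤ h → x ⊕ d ≡ x ⊖ d → d ≡ 0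
  ⊕≡⊖⇒≡0 {x} {zero}  _   _   = refl
  ⊕≡⊖⇒≡0 {x} {suc d} d≤h ⊕≡⊖ = ⊥-elim (⊕≢⊖ x (s≤s z≤n) d≤h ⊕≡⊖)

  -- For a residue e < V, ∣ e ∣ᵥ = min e (V ∸ e), so dist is the circular distance on ℤ_V.
  ∣_∣ᵥ : ℕ → ℕ
  ∣ e ∣ᵥ with e ≤? h
  ... | yes _ = e
  ... | no  _ = V ∸ e

  ∣∣ᵥ-small : ∀ {e} → e ≤ h → ∣ e ∣ᵥ ≡ e
  ∣∣ᵥ-small {e} e≤h with e ≤? h
  ... | yes _   = refl
  ... | no  e≰h = ⊥-elim (e≰h e≤h)

  ∣∣ᵥ-large : ∀ {e} → h < e → ∣ e ∣ᵥ ≡ V ∸ e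
  ∣∣ᵥ-large {e} h<e with e ≤? h
  ... | yes e≤h = ⊥-elim (ℕ.<⇒≱ h<e e≤h)
  ... | no  _   = refl

  h<⇒V∸≤h : ∀ {e} → h < e → V ∸ e ≤ h
  h<⇒V∸≤h h<e = ℕ.≤-trans (ℕ.∸-monoʳ-≤ V h<e) (ℕ.≤-reflexive (ℕ.m+n∸n≡m h h))

  ∣∣ᵥ≤h : ∀ e → ∣ e ∣ᵥ ≤ h
  ∣∣ᵥ≤h e with e ≤? h
  ... | yes e≤h = e≤h
  ... | no  e≰h = h<⇒V∸≤h (ℕ.≰⇒> e≰h)

  ≤h⇒h<V∸ : ∀ {d} → d ≤ h → h < V ∸ d
  ≤h⇒h<V∸ {d} d≤h = ℕ.≤-trans (ℕ.≤-reflexive (sym (ℕ.m+n∸n≡m (suc h) h))) (ℕ.∸-monoʳ-≤ V d≤h)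

  ∣∣ᵥ-neg : ∀ {e} → 0 < e → e < V → ∣ V ∸ e ∣ᵥ ≡ ∣ e ∣ᵥ
  ∣∣ᵥ-neg {e} 0<e e<V with e ≤? h
  ... | yes e≤h = trans (∣∣ᵥ-large (≤h⇒h<V∸ e≤h)) (ℕ.m∸[m∸n]≡n (ℕ.<⇒≤ e<V))
  ... | no  e≰h = ∣∣ᵥ-small (h<⇒V∸≤h (ℕ.≰⇒> e≰h))

  ∣∣ᵥ≡⇒ : ∀ {e d} → e < V → ∣ e ∣ᵥ ≡ d → e ≡ d ⊎ e ≡ V ∸ d
  ∣∣ᵥ≡⇒ {e} e<V refl with e ≤? h
  ... | yes _ = inj₁ refl
  ... | no  _ = inj₂ (sym (ℕ.m∸[m∸n]≡n (ℕ.<⇒≤ e<V)))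

  dist : ℕ → ℕ → ℕ
  dist x y = ∣ y ⊖ x ∣ᵥ

  dist≤h : ∀ x y → dist x y ≤ h
  dist≤h x y = ∣∣ᵥ≤h (y ⊖ x)

  dist≤V : ∀ x y → dist x y ≤ V
  dist≤V x y = ℕ.<⇒≤ (≤h⇒<V (dist≤h x y))

  dist-self : ∀ {x} → x < V → dist x x ≡ 0
  dist-self x<V = trans (cong ∣_∣ᵥ (x⊖x≡0 x<V)) (∣∣ᵥ-small z≤n)

  dist-⊕ : ∀ {x d} → x < V → d ≤ h → dist x (x ⊕ d) ≡ d
  dist-⊕ x<V d≤h = trans (cong ∣_∣ᵥ ([x⊕d]⊖x≡d x<V (≤h⇒<V d≤h))) (∣∣ᵥ-small d≤h)

  dist-⊖ : ∀ {x d} → x < V → d ≤ h → dist x (x ⊖ d) ≡ d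
  dist-⊖ {x} {zero}  x<V _   = trans (cong (dist x) (⊖-identityʳ x<V)) (dist-self x<V)
  dist-⊖ {x} {suc d} x<V d≤h = begin
    ∣ x ⊖ suc d ⊖ x ∣ᵥ
      ≡⟨ cong ∣_∣ᵥ ([x⊕d]⊖x≡d x<V (ℕ.∸-monoʳ-< (s≤s z≤n) (ℕ.<⇒≤ (≤h⇒<V d≤h)))) ⟩
    ∣ V ∸ suc d ∣ᵥ
      ≡⟨ ∣∣ᵥ-neg (s≤s z≤n) (≤h⇒<V d≤h) ⟩
    ∣ suc d ∣ᵥ
      ≡⟨ ∣∣ᵥ-small d≤h ⟩
    suc d ∎
    where open ≡-Reasoning

  dist≡⇒ : ∀ {x y d} → x < V → y < V → dist x y ≡ d → y ≡ x ⊕ d ⊎ y ≡ x ⊖ d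
  dist≡⇒ {x} {y} x<V y<V dist≡d with ∣∣ᵥ≡⇒ (⊕<V y (V ∸ x)) dist≡d
  ... | inj₁ e = inj₁ (trans (sym (x⊕[y⊖x]≡y x<V y<V)) (cong (x ⊕_) e))
  ... | inj₂ e = inj₂ (trans (sym (x⊕[y⊖x]≡y x<V y<V)) (cong (x ⊕_) e))

  dist≡0⇒ : ∀ {x y} → x < V → y < V → dist x y ≡ 0 → y ≡ x
  dist≡0⇒ x<V y<V dist≡0 with dist≡⇒ x<V y<V dist≡0
  ... | inj₁ y≡x⊕0 = trans y≡x⊕0 (⊕-identityʳ x<V)
  ... | inj₂ y≡x⊖0 = trans y≡x⊖0 (⊖-identityʳ x<V)

  dist-sym : ∀ {x y} → x < V → y < V → dist x y ≡ dist y x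
  dist-sym {x} {y} x<V y<V = sym ([ via-⊕ , via-⊖ ]′ (dist≡⇒ x<V y<V refl))
    where
    open ≡-Reasoning
    d : ℕ
    d = dist x y
    via-⊕ : y ≡ x ⊕ d → dist y x ≡ d
    via-⊕ y≡x⊕d = begin
      dist y x         ≡⟨ cong (dist y) ([x⊕d]⊖d≡x x<V (dist≤V x y)) ⟨
      dist y (x ⊕ d ⊖ d) ≡⟨ cong (λ z → dist y (z ⊖ d)) y≡x⊕d ⟨
      dist y (y ⊖ d)   ≡⟨ dist-⊖ y<V (dist≤h x y) ⟩
      d                ∎
    via-⊖ : y ≡ x ⊖ d → dist y x ≡ d
    via-⊖ y≡x⊖d = begin
      dist y x         ≡⟨ cong (dist y) ([x⊖d]⊕d≡x x<V (dist≤V x y)) ⟨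
      dist y (x ⊖ d ⊕ d) ≡⟨ cong (λ z → dist y (z ⊕ d)) y≡x⊖d ⟨
      dist y (y ⊕ d)   ≡⟨ dist-⊕ y<V (dist≤h x y) ⟩
      d                ∎

  equidistant⇒+≈ : ∀ {x y₁ y₂} → x < V → y₁ < V → y₂ < V → y₁ ≢ y₂ →
                   dist x y₁ ≡ dist x y₂ → y₁ + y₂ ≈ x + x
  equidistant⇒+≈ {x} {y₁} {y₂} x<V y₁<V y₂<V y₁≢y₂ same
    with dist≡⇒ x<V y₁<V refl | dist≡⇒ x<V y₂<V (sym same)
  ... | inj₁ y₁≡ | inj₁ y₂≡ = ⊥-elim (y₁≢y₂ (trans y₁≡ (sym y₂≡)))
  ... | inj₂ y₁≡ | inj₂ y₂≡ = ⊥-elim (y₁≢y₂ (trans y₁≡ (sym y₂≡)))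
  ... | inj₁ y₁≡ | inj₂ y₂≡ =
    ≈-trans (≡⇒≈ (cong₂ _+_ y₁≡ y₂≡)) ([x⊕d]+[x⊖d]≈x+x x (dist≤V x y₁))
  ... | inj₂ y₁≡ | inj₁ y₂≡ =
    ≈-trans (≡⇒≈ (cong₂ _+_ y₁≡ y₂≡)) ([x⊖d]+[x⊕d]≈x+x x (dist≤V x y₁))

  +≈⇒equidistant : ∀ {x y₁ y₂} → x < V → y₁ < V → y₂ < V →
                   y₁ + y₂ ≈ x + x → dist x y₁ ≡ dist x y₂
  +≈⇒equidistant {x} {y₁} {y₂} x<V y₁<V y₂<V y₁+y₂≈x+x =
    sym ([ via-⊕ , via-⊖ ]′ (dist≡⇒ x<V y₁<V refl))
    where
    d : ℕ
    d = dist x y₁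
    y₂≡ : ∀ {z} → z < V → y₁ + z ≈ x + x → y₂ ≡ z
    y₂≡ z<V y₁+z≈x+x = ≈⇒≡ y₂<V z<V (+-cancelˡ-≈ y₁ (≈-trans y₁+y₂≈x+x (≈-sym y₁+z≈x+x)))
    via-⊕ : y₁ ≡ x ⊕ d → dist x y₂ ≡ d
    via-⊕ y₁≡ = trans (cong (dist x) (y₂≡ (⊕<V x (V ∸ d))
      (≈-trans (≡⇒≈ (cong (_+ (x ⊖ d)) y₁≡)) ([x⊕d]+[x⊖d]≈x+x x (dist≤V x y₁))))) (dist-⊖ x<V (dist≤h x y₁))
    via-⊖ : y₁ ≡ x ⊖ d → dist x y₂ ≡ d
    via-⊖ y₁≡ = trans (cong (dist x) (y₂≡ (⊕<V x d)
      (≈-trans (≡⇒≈ (cong (_+ (x ⊕ d)) y₁≡)) ([x⊖d]+[x⊕d]≈x+x x (dist≤V x y₁))))) (dist-⊕ x<V (dist≤h x y₁))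

  dist≡⇔ : ∀ {x y d} → x < V → y < V → d ≤ h → dist x y ≡ d ⇔ (x ≡ y ⊖ d ⊎ x ≡ y ⊕ d)
  dist≡⇔ {x} {y} {d} x<V y<V d≤h = mk⇔ to from
    where
    to : dist x y ≡ d → x ≡ y ⊖ d ⊎ x ≡ y ⊕ d
    to dist≡d = ⊎-swap (dist≡⇒ y<V x<V (trans (sym (dist-sym x<V y<V)) dist≡d))
    from : x ≡ y ⊖ d ⊎ x ≡ y ⊕ d → dist x y ≡ d
    from (inj₁ refl) = trans (dist-sym x<V y<V) (dist-⊖ y<V d≤h)
    from (inj₂ refl) = trans (dist-sym x<V y<V) (dist-⊕ y<V d≤h)

  ⊕-mod-3 : 3 ∣ V → ∀ y d → (y ⊕ d) % 3 ≡ (y + d) % 3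
  ⊕-mod-3 3∣V y d = m∣n⇒o%n%m≡o%m 3 V (y + d) 3∣V

  ⊖-mod-3 : 3 ∣ V → ∀ y {d} → d ≤ V → (y ⊖ d) % 3 ≡ (y + (d + d)) % 3
  ⊖-mod-3 3∣V y {d} d≤V = begin
    (y ⊖ d) % 3                         ≡⟨ ⊕-mod-3 3∣V y (V ∸ d) ⟩
    (y + (V ∸ d)) % 3                   ≡⟨ [m+kn]%n≡m%n (y + (V ∸ d)) d 3 ⟨
    (y + (V ∸ d) + d * 3) % 3           ≡⟨ cong (_% 3) (rearrange y (V ∸ d) d) ⟩
    (y + (d + d) + ((V ∸ d) + d)) % 3   ≡⟨ cong (λ z → (y + (d + d) + z) % 3) (ℕ.m∸n+n≡m d≤V) ⟩
    (y + (d + d) + V) % 3               ≡⟨ %-remove-+ʳ (y + (d + d)) 3∣V ⟩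
    (y + (d + d)) % 3                   ∎
    where
    open ≡-Reasoning
    rearrange : ∀ y w d → y + w + d * 3 ≡ y + (d + d) + (w + d)
    rearrange = solve-∀

  -- The midpoint (y₁ + y₂) / 2 in ℤ_V.
  mid : ℕ → ℕ → ℕ
  mid y₁ y₂ = ((y₁ + y₂) * suc h) % V

  mid<V : ∀ y₁ y₂ → mid y₁ y₂ < V
  mid<V y₁ y₂ = m%n<n ((y₁ + y₂) * suc h) V

  mid+mid≈y₁+y₂ : ∀ y₁ y₂ → mid y₁ y₂ + mid y₁ y₂ ≈ y₁ + y₂
  mid+mid≈y₁+y₂ y₁ y₂ = begin
    mid y₁ y₂ + mid y₁ y₂   ≈⟨ +-cong (%-≈ (s * suc h)) (%-≈ (s * suc h)) ⟩
    s * suc h + s * suc h   ≡⟨ double s h ⟩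
    s + s * V               ≈⟨ +*V-≈ s s ⟩
    s                       ∎
    where
    open ≈-Reasoning
    s = y₁ + y₂
    double : ∀ s h → s * suc h + s * suc h ≡ s + s * suc (h + h)
    double = solve-∀

  +≈⇒mid : ∀ {x y₁ y₂} → x < V → y₁ + y₂ ≈ x + x → x ≡ mid y₁ y₂
  +≈⇒mid {x} {y₁} {y₂} x<V sum =
    ≈⇒≡ x<V (mid<V y₁ y₂) (double-injective (≈-trans (≈-sym sum) (≈-sym (mid+mid≈y₁+y₂ y₁ y₂))))

-- The doubling construction STS(V) ↦ STS(2V + 1)

Admissible : ℕ → ℤ → Set
Admissible n z = z ≢ 0ℤ × ℤ.∣ z ∣ < n

module Doubling (h : ℕ) where

  open Cyclic h public

  N : ℕ
  N = 2 * V + 1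

  N≡1+V+V : ∀ v → 2 * v + 1 ≡ suc (v + v)
  N≡1+V+V = solve-∀

  ≤V+V⇒<N : ∀ {k} → k ≤ V + V → k < N
  ≤V+V⇒<N {k} k≤V+V = subst (k <_) (sym (N≡1+V+V V)) (s≤s k≤V+V)

  <N⇒≤V+V : ∀ {k} → k < N → k ≤ V + V
  <N⇒≤V+V {k} k<N = ℕ.≤-pred (subst (k <_) (N≡1+V+V V) k<N)

  V+<N : ∀ {y} → y < V → V + y < N
  V+<N y<V = ≤V+V⇒<N (ℕ.+-monoʳ-≤ V (ℕ.<⇒≤ y<V))

  <V⇒<V+ : ∀ {x} k → x < V → x < V + k
  <V⇒<V+ k x<V = ℕ.≤-trans x<V (ℕ.m≤m+n V k)

  data Point : ℕ → Set where
    old : ∀ {x} → x < V → Point x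
    new : ∀ {y} → y < V → Point (V + y)
    ∞   : Point (V + V)

  point : ∀ {k} → k < N → Point k
  point {k} k<N with k ℕ.<? V
  ... | yes k<V = old k<V
  ... | no  k≮V = subst Point (ℕ.m+[n∸m]≡n (ℕ.≮⇒≥ k≮V)) (point-above (k ∸ V) k∸V≤V)
    where
    k∸V≤V : k ∸ V ≤ V
    k∸V≤V = ℕ.≤-trans (ℕ.∸-monoˡ-≤ V (<N⇒≤V+V k<N)) (ℕ.≤-reflexive (ℕ.m+n∸m≡n V V))
    point-above : ∀ y → y ≤ V → Point (V + y)
    point-above y y≤V with ℕ.m≤n⇒m<n∨m≡n y≤V
    ... | inj₁ y<V  = new y<V
    ... | inj₂ refl = ∞

  -- B x d = {x, V + (x ⊕ d), third x d}, where the third point is V + (x ⊖ d) unless x ⊖ d = x ⊕ d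
  -- (for d ≤ h only when d = 0), and then ∞.
  third : ℕ → ℕ → ℕ
  third x d with x ⊕ d ≟ x ⊖ d
  ... | yes _ = V + V
  ... | no  _ = V + (x ⊖ d)

  third-view : ∀ x d → (x ⊕ d ≡ x ⊖ d × third x d ≡ V + V)
                     ⊎ (x ⊕ d ≢ x ⊖ d × third x d ≡ V + (x ⊖ d))
  third-view x d with x ⊕ d ≟ x ⊖ d
  ... | yes ⊕≡⊖ = inj₁ (⊕≡⊖ , refl)
  ... | no  ⊕≢⊖ = inj₂ (⊕≢⊖ , refl)

  V+≢<V : ∀ {x k} → x < V → V + k ≢ x
  V+≢<V x<V V+k≡x = ℕ.<⇒≱ x<V (subst (V ≤_) V+k≡x (ℕ.m≤m+n V _))

  V+-injective : ∀ {y z} → V + y ≡ V + z → y ≡ z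
  V+-injective = ℕ.+-cancelˡ-≡ V _ _

  V≤third : ∀ x d → V ≤ third x d
  V≤third x d with third-view x d
  ... | inj₁ (_ , t≡) = subst (V ≤_) (sym t≡) (ℕ.m≤m+n V V)
  ... | inj₂ (_ , t≡) = subst (V ≤_) (sym t≡) (ℕ.m≤m+n V _)

  third<N : ∀ x d → third x d < N
  third<N x d with third-view x d
  ... | inj₁ (_ , t≡) = subst (_< N) (sym t≡) (≤V+V⇒<N ℕ.≤-refl)
  ... | inj₂ (_ , t≡) = subst (_< N) (sym t≡) (V+<N (⊕<V x (V ∸ d)))

  ⊕-≢-third : ∀ x d → V + (x ⊕ d) ≢ third x d
  ⊕-≢-third x d with third-view x d
  ... | inj₁ (_ , t≡)   = λ e → ℕ.<⇒≢ (⊕<V x d) (V+-injective (trans e t≡))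
  ... | inj₂ (⊕≢⊖ , t≡) = λ e → ⊕≢⊖ (V+-injective (trans e t≡))

  -- Opaque: unfolding B exposes residue computations and makes typechecking the sums very slow.
  opaque
    B : ℕ → ℕ → Triple N
    B x d = block x′ (V + (x′ ⊕ d)) (third x′ d)
              (<V⇒<V+ _ x′<V) (ℕ.<-≤-trans x′<V (V≤third x′ d)) (⊕-≢-third x′ d)
              (V+<N (⊕<V x′ d)) (third<N x′ d)
      where
      x′ : ℕ
      x′ = x % V
      x′<V : x′ < V
      x′<V = m%n<n x V

    ∈ᴺ-B : ∀ {k x d} → x < V → k ∈ᴺ B x d ⇔ (k ≡ x ⊎ k ≡ V + (x ⊕ d) ⊎ k ≡ third x d)
    ∈ᴺ-B {k} {x} {d} x<V =
      subst (λ z → k ∈ᴺ B x d ⇔ (k ≡ z ⊎ k ≡ V + (z ⊕ d) ⊎ k ≡ third z d)) (m<n⇒m%n≡m x<V)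
        (∈ᴺ-block _ _ _ _ _)

    a-B : ∀ {x d} → x < V → toℕ (a (B x d)) ≡ x
    a-B {x} {d} x<V =
      trans (a-block {i = x % V} {j = V + (x % V ⊕ d)} {k = third (x % V) d} _ _ _ _ _) (m<n⇒m%n≡m x<V)

  old∈B⇔ : ∀ {k x d} → k < V → x < V → k ∈ᴺ B x d ⇔ k ≡ x
  old∈B⇔ {k} {x} {d} k<V x<V = ⇔-trans (∈ᴺ-B x<V) (mk⇔ to inj₁)
    where
    to : k ≡ x ⊎ k ≡ V + (x ⊕ d) ⊎ k ≡ third x d → k ≡ x
    to (inj₁ k≡x)        = k≡x
    to (inj₂ (inj₁ k≡j)) = ⊥-elim (V+≢<V k<V (sym k≡j))
    to (inj₂ (inj₂ k≡t)) = ⊥-elim (ℕ.<⇒≱ k<V (subst (V ≤_) (sym k≡t) (V≤third x d)))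

  new∈B⇔ : ∀ {y x d} → y < V → x < V → d ≤ h → V + y ∈ᴺ B x d ⇔ dist x y ≡ d
  new∈B⇔ {y} {x} {d} y<V x<V d≤h = ⇔-trans (∈ᴺ-B x<V) (mk⇔ to from)
    where
    to : V + y ≡ x ⊎ V + y ≡ V + (x ⊕ d) ⊎ V + y ≡ third x d → dist x y ≡ d
    to (inj₁ V+y≡x)      = ⊥-elim (V+≢<V x<V V+y≡x)
    to (inj₂ (inj₁ e))   = trans (cong (dist x) (V+-injective e)) (dist-⊕ x<V d≤h)
    to (inj₂ (inj₂ e)) with third-view x d
    ... | inj₁ (_ , t≡) = ⊥-elim (ℕ.<⇒≢ y<V (V+-injective (trans e t≡)))
    ... | inj₂ (_ , t≡) = trans (cong (dist x) (V+-injective (trans e t≡))) (dist-⊖ x<V d≤h)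
    from : dist x y ≡ d → V + y ≡ x ⊎ V + y ≡ V + (x ⊕ d) ⊎ V + y ≡ third x d
    from dist≡d with dist≡⇒ x<V y<V dist≡d | third-view x d
    ... | inj₁ y≡x⊕d | _                  = inj₂ (inj₁ (cong (V +_) y≡x⊕d))
    ... | inj₂ y≡x⊖d | inj₁ (⊕≡⊖ , _)     = inj₂ (inj₁ (cong (V +_) (trans y≡x⊖d (sym ⊕≡⊖))))
    ... | inj₂ y≡x⊖d | inj₂ (_ , t≡)      = inj₂ (inj₂ (trans (cong (V +_) y≡x⊖d) (sym t≡)))

  ∞∈B⇔ : ∀ {x d} → x < V → d ≤ h → V + V ∈ᴺ B x d ⇔ d ≡ 0
  ∞∈B⇔ {x} {d} x<V d≤h = ⇔-trans (∈ᴺ-B x<V) (mk⇔ to from)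
    where
    to : V + V ≡ x ⊎ V + V ≡ V + (x ⊕ d) ⊎ V + V ≡ third x d → d ≡ 0
    to (inj₁ V+V≡x)    = ⊥-elim (V+≢<V x<V V+V≡x)
    to (inj₂ (inj₁ e)) = ⊥-elim (ℕ.<⇒≢ (⊕<V x d) (sym (V+-injective e)))
    to (inj₂ (inj₂ e)) with third-view x d
    ... | inj₁ (⊕≡⊖ , _) = ⊕≡⊖⇒≡0 {x} d≤h ⊕≡⊖
    ... | inj₂ (_ , t≡)  = ⊥-elim (ℕ.<⇒≢ (⊕<V x (V ∸ d)) (sym (V+-injective (trans e t≡))))
    from : d ≡ 0 → V + V ≡ x ⊎ V + V ≡ V + (x ⊕ d) ⊎ V + V ≡ third x d
    from refl with third-view x 0
    ... | inj₁ (_ , t≡)   = inj₂ (inj₂ (sym t≡))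
    ... | inj₂ (⊕≢⊖ , _)  = ⊥-elim (⊕≢⊖ (trans (⊕-identityʳ x<V) (sym (⊖-identityʳ x<V))))

  ∈B-above-x⇒V≤ : ∀ {x d k} → x < V → Point k → k ∈ᴺ B x d → x < k → V ≤ k
  ∈B-above-x⇒V≤ x<V (old k<V) k∈B x<k = ⊥-elim (ℕ.<⇒≢ x<k (sym (Equivalence.to (old∈B⇔ k<V x<V) k∈B)))
  ∈B-above-x⇒V≤ x<V (new _)   _   _   = ℕ.m≤m+n V _
  ∈B-above-x⇒V≤ x<V ∞         _   _   = ℕ.m≤m+n V V

  ∈B-above-x⇒dist≡ : ∀ {x d k} → x < V → d ≤ h → Point k → k ∈ᴺ B x d → x < k → k < V + V →
                  dist x (k ∸ V) ≡ d
  ∈B-above-x⇒dist≡ x<V d≤h (old k<V) k∈B x<k _ =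
    ⊥-elim (ℕ.<⇒≢ x<k (sym (Equivalence.to (old∈B⇔ k<V x<V) k∈B)))
  ∈B-above-x⇒dist≡ {x} {d} x<V d≤h (new {y} y<V) k∈B _ _ =
    trans (cong (dist x) (ℕ.m+n∸m≡n V y)) (Equivalence.to (new∈B⇔ y<V x<V d≤h) k∈B)
  ∈B-above-x⇒dist≡ x<V d≤h ∞ _ _ V+V<V+V = ⊥-elim (ℕ.<-irrefl refl V+V<V+V)

  V≤c-B : ∀ {x d} → x < V → V ≤ toℕ (c (B x d))
  V≤c-B {x} {d} x<V = ∈B-above-x⇒V≤ x<V (point (Fin.toℕ<n (c t))) (inj₂ (inj₂ refl))
    (subst (_< toℕ (c t)) (a-B x<V) (ℕ.<-trans (a<b t) (b<c t)))
    where
    t : Triple N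
    t = B x d

  dist-b-B : ∀ {x d} → x < V → d ≤ h → dist x (toℕ (b (B x d)) ∸ V) ≡ d
  dist-b-B {x} {d} x<V d≤h = ∈B-above-x⇒dist≡ x<V d≤h (point (Fin.toℕ<n (b t))) (inj₂ (inj₁ refl))
    (subst (_< toℕ (b t)) (a-B x<V) (a<b t)) (ℕ.<-≤-trans (b<c t) (<N⇒≤V+V (Fin.toℕ<n (c t))))
    where
    t : Triple N
    t = B x d

  record UniqueNewBlock (k₁ k₂ : ℕ) : Set where
    field
      x₀ d₀ : ℕ
      x₀<V  : x₀ < V
      d₀≤h  : d₀ ≤ h
      spec  : ∀ {x d} → x < V → d ≤ h → (k₁ ∈ᴺ B x d × k₂ ∈ᴺ B x d) ⇔ (x ≡ x₀ × d ≡ d₀)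

  UniqueNewBlock-sym : ∀ {k₁ k₂} → UniqueNewBlock k₁ k₂ → UniqueNewBlock k₂ k₁
  UniqueNewBlock-sym u = record
    { x₀ = x₀ ; d₀ = d₀ ; x₀<V = x₀<V ; d₀≤h = d₀≤h
    ; spec = λ x<V d≤h → ⇔-trans (mk⇔ ×-swap ×-swap) (spec x<V d≤h)
    }
    where open UniqueNewBlock u

  unique-old-new : ∀ {x₁ y} → x₁ < V → y < V → UniqueNewBlock x₁ (V + y)
  unique-old-new {x₁} {y} x₁<V y<V = record
    { x₀ = x₁ ; d₀ = dist x₁ y ; x₀<V = x₁<V ; d₀≤h = dist≤h x₁ y
    ; spec = λ x<V d≤h → ⇔-trans (old∈B⇔ x₁<V x<V ×-⇔ new∈B⇔ y<V x<V d≤h) (mk⇔ to from)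
    }
    where
    to : ∀ {x d} → x₁ ≡ x × dist x y ≡ d → x ≡ x₁ × d ≡ dist x₁ y
    to (refl , refl) = refl , refl
    from : ∀ {x d} → x ≡ x₁ × d ≡ dist x₁ y → x₁ ≡ x × dist x y ≡ d
    from (refl , refl) = refl , refl

  unique-old-∞ : ∀ {x₁} → x₁ < V → UniqueNewBlock x₁ (V + V)
  unique-old-∞ {x₁} x₁<V = record
    { x₀ = x₁ ; d₀ = 0 ; x₀<V = x₁<V ; d₀≤h = z≤n
    ; spec = λ x<V d≤h → ⇔-trans (old∈B⇔ x₁<V x<V ×-⇔ ∞∈B⇔ x<V d≤h)
                                  (mk⇔ (map₁ sym) (map₁ sym))
    }

  unique-new-∞ : ∀ {y} → y < V → UniqueNewBlock (V + y) (V + V)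
  unique-new-∞ {y} y<V = record
    { x₀ = y ; d₀ = 0 ; x₀<V = y<V ; d₀≤h = z≤n
    ; spec = λ x<V d≤h → ⇔-trans (new∈B⇔ y<V x<V d≤h ×-⇔ ∞∈B⇔ x<V d≤h) (mk⇔ (to x<V) from)
    }
    where
    to : ∀ {x d} → x < V → dist x y ≡ d × d ≡ 0 → x ≡ y × d ≡ 0
    to x<V (dist≡d , refl) = sym (dist≡0⇒ x<V y<V dist≡d) , refl
    from : ∀ {x d} → x ≡ y × d ≡ 0 → dist x y ≡ d × d ≡ 0
    from (refl , refl) = dist-self y<V , refl

  unique-new-new : ∀ {y₁ y₂} → y₁ < V → y₂ < V → y₁ ≢ y₂ → UniqueNewBlock (V + y₁) (V + y₂)
  unique-new-new {y₁} {y₂} y₁<V y₂<V y₁≢y₂ = record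
    { x₀ = m ; d₀ = dist m y₁ ; x₀<V = mid<V y₁ y₂ ; d₀≤h = dist≤h m y₁
    ; spec = λ x<V d≤h →
        ⇔-trans (new∈B⇔ y₁<V x<V d≤h ×-⇔ new∈B⇔ y₂<V x<V d≤h) (mk⇔ (to x<V) from)
    }
    where
    m : ℕ
    m = mid y₁ y₂
    to : ∀ {x d} → x < V → dist x y₁ ≡ d × dist x y₂ ≡ d → x ≡ m × d ≡ dist m y₁
    to {x} x<V (refl , e₂) = x≡m , cong (λ z → dist z y₁) x≡m
      where
      x≡m : x ≡ m
      x≡m = +≈⇒mid {y₁ = y₁} {y₂} x<V (equidistant⇒+≈ x<V y₁<V y₂<V y₁≢y₂ (sym e₂))
    from : ∀ {x d} → x ≡ m × d ≡ dist m y₁ → dist x y₁ ≡ d × dist x y₂ ≡ d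
    from (refl , refl) =
      refl , sym (+≈⇒equidistant (mid<V y₁ y₂) y₁<V y₂<V (≈-sym (mid+mid≈y₁+y₂ y₁ y₂)))

  no-two-old : ∀ {k₁ k₂ x d} → k₁ < V → k₂ < V → k₁ ≢ k₂ → x < V →
               ¬ (k₁ ∈ᴺ B x d × k₂ ∈ᴺ B x d)
  no-two-old k₁<V k₂<V k₁≢k₂ x<V (k₁∈ , k₂∈) =
    k₁≢k₂ (trans (Equivalence.to (old∈B⇔ k₁<V x<V) k₁∈)
                 (sym (Equivalence.to (old∈B⇔ k₂<V x<V) k₂∈)))

  UniqueNewBlock⇒¬old : ∀ {k₁ k₂} → UniqueNewBlock k₁ k₂ → k₁ ≢ k₂ → ¬ (k₁ < V × k₂ < V)
  UniqueNewBlock⇒¬old u k₁≢k₂ (k₁<V , k₂<V) =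
    no-two-old k₁<V k₂<V k₁≢k₂ x₀<V (Equivalence.from (spec x₀<V d₀≤h) (refl , refl))
    where open UniqueNewBlock u

  pair-view : ∀ {k₁ k₂} → Point k₁ → Point k₂ → k₁ ≢ k₂ →
              (k₁ < V × k₂ < V) ⊎ UniqueNewBlock k₁ k₂
  pair-view (old p) (old q) _  = inj₁ (p , q)
  pair-view (old p) (new q) _  = inj₂ (unique-old-new p q)
  pair-view (old p) ∞       _  = inj₂ (unique-old-∞ p)
  pair-view (new p) (old q) _  = inj₂ (UniqueNewBlock-sym (unique-old-new q p))
  pair-view (new p) (new q) ne = inj₂ (unique-new-new p q (ne ∘ cong (V +_)))
  pair-view (new p) ∞       _  = inj₂ (unique-new-∞ p)
  pair-view ∞       (old q) _  = inj₂ (UniqueNewBlock-sym (unique-old-∞ q))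
  pair-view ∞       (new q) _  = inj₂ (UniqueNewBlock-sym (unique-new-∞ q))
  pair-view ∞       ∞       ne = ⊥-elim (ne refl)

  newBlocks : List (Triple N)
  newBlocks = concat (applyDownFrom (λ x → applyDownFrom (B x) (suc h)) V)

  ∈-newBlocks⁻ : ∀ {t} → t ∈ newBlocks → ∃ λ x → ∃ λ d → x < V × d ≤ h × t ≡ B x d
  ∈-newBlocks⁻ {t} t∈ =
    let row , t∈row , row∈ = ∈-concat⁻′ (applyDownFrom (λ x → applyDownFrom (B x) (suc h)) V) t∈
        x , x<V , row≡       = ∈-applyDownFrom⁻ (λ x → applyDownFrom (B x) (suc h)) row∈
        d , d<1+h , t≡       = ∈-applyDownFrom⁻ (B x) (subst (t ∈_) row≡ t∈row)
    in x , d , x<V , ℕ.≤-pred d<1+h , t≡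

  count-newBlocks-unique : ∀ {k₁ k₂} → UniqueNewBlock k₁ k₂ → pairCount k₁ k₂ newBlocks ≡ 1
  count-newBlocks-unique {k₁} {k₂} u = begin
    pairCount k₁ k₂ newBlocks
      ≡⟨ Σℕ.sumWhere-grid (bothIn k₁ k₂) (const 1) B V (suc h) ⟩
    Σ< V (λ x → Σ< (suc h) (λ d → [ bothIn k₁ k₂ (B x d) ]· 1))
      ≡⟨ Σ<-cong V (λ x x<V → Σ<-cong (suc h) (λ d d<1+h →
           cong ([_]· 1) (does-⇔ (spec x<V (ℕ.≤-pred d<1+h))
                                 (k₁ ∈ᴺ? B x d ×-dec k₂ ∈ᴺ? B x d) (x ≟ x₀ ×-dec d ≟ d₀)))) ⟩
    Σ< V (λ x → Σ< (suc h) (λ d → [ does (x ≟ x₀) ∧ does (d ≟ d₀) ]· 1))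
      ≡⟨ Σ<-delta₂ V (suc h) (λ _ _ → 1) x₀<V (s≤s d₀≤h) ⟩
    1 ∎
    where
    open ≡-Reasoning
    open Σℕ
    open UniqueNewBlock u

  count-newBlocks-old : ∀ {k₁ k₂} → k₁ < V → k₂ < V → k₁ ≢ k₂ → pairCount k₁ k₂ newBlocks ≡ 0
  count-newBlocks-old {k₁} {k₂} k₁<V k₂<V k₁≢k₂ =
    trans (Σℕ.sumWhere-grid (bothIn k₁ k₂) (const 1) B V (suc h))
      (Σℕ.Σ<-zero V (λ x x<V → Σℕ.Σ<-zero (suc h) (λ d _ →
        cong (Σℕ.[_]· 1) (dec-false (k₁ ∈ᴺ? B x d ×-dec k₂ ∈ᴺ? B x d)
                                    (no-two-old k₁<V k₂<V k₁≢k₂ x<V)))))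

  V≤N : V ≤ N
  V≤N = ℕ.<⇒≤ (≤V+V⇒<N (ℕ.m≤m+n V V))

  ι : Fin V → Fin N
  ι i = fromℕ< (ℕ.<-≤-trans (Fin.toℕ<n i) V≤N)

  toℕ-ι : ∀ i → toℕ (ι i) ≡ toℕ i
  toℕ-ι i = Fin.toℕ-fromℕ< _

  ι-injective : Injective _≡_ _≡_ ι
  ι-injective {i} {j} ιi≡ιj = Fin.toℕ-injective (trans (sym (toℕ-ι i)) (trans (cong toℕ ιi≡ιj) (toℕ-ι j)))

  lift : Triple V → Triple N
  lift t = ⟨ toℕ (a t) , toℕ (b t) , toℕ (c t) ⟩ (a<b t) (b<c t) (ℕ.<-≤-trans (Fin.toℕ<n (c t)) V≤N)

  ∈ᴺ-lift : ∀ {k} t → k ∈ᴺ lift t ⇔ k ∈ᴺ t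
  ∈ᴺ-lift t = ∈ᴺ-⟨⟩ (a<b t) (b<c t) _

  bothIn-lift : ∀ k₁ k₂ t → bothIn k₁ k₂ (lift t) ≡ bothIn k₁ k₂ t
  bothIn-lift k₁ k₂ t =
    does-⇔ (∈ᴺ-lift t ×-⇔ ∈ᴺ-lift t)
           (k₁ ∈ᴺ? lift t ×-dec k₂ ∈ᴺ? lift t) (k₁ ∈ᴺ? t ×-dec k₂ ∈ᴺ? t)

  lower : (t : Triple N) → toℕ (c t) < V → Triple V
  lower t c<V = ⟨ toℕ (a t) , toℕ (b t) , toℕ (c t) ⟩ (a<b t) (b<c t) c<V

  lower-lift : ∀ t c<V → lower (lift t) c<V ≡ t
  lower-lift t c<V = Triple-≡
    (Fin.toℕ-injective (trans (a-⟨⟩ _ _ c<V) (a-⟨⟩ (a<b t) (b<c t) _)))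
    (Fin.toℕ-injective (trans (b-⟨⟩ _ _ c<V) (b-⟨⟩ (a<b t) (b<c t) _)))
    (Fin.toℕ-injective (trans (c-⟨⟩ _ _ c<V) (c-⟨⟩ (a<b t) (b<c t) _)))

  -- The values of w on the new blocks through V + y: B y 0 and, for d ≥ 1, B (y ⊖ d) d and B (y ⊕ d) d.
  atNewPoint : (ℕ → ℕ → ℤ) → ℕ → ℕ → ℤ
  atNewPoint w y zero    = w y 0
  atNewPoint w y (suc e) = w (y ⊖ suc e) (suc e) ℤ.+ w (y ⊕ suc e) (suc e)

  record Balanced (n : ℕ) (w : ℕ → ℕ → ℤ) : Set where
    field
      admissible : ∀ x d → Admissible n (w x d)
      Σ-old      : ∀ {x} → x < V → Σℤ.Σ< (suc h) (w x) ≡ 0ℤ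
      Σ-∞        : Σℤ.Σ< V (λ x → w x 0) ≡ 0ℤ
      Σ-new      : ∀ {y} → y < V → Σℤ.Σ< (suc h) (atNewPoint w y) ≡ 0ℤ

  Σ-dist≡ : ∀ w {y d} → y < V → d ≤ h →
             Σℤ.Σ< V (λ x → Σℤ.[ does (dist x y ≟ d) ]· w x d) ≡ atNewPoint w y d
  Σ-dist≡ w {y} {zero} y<V _ = begin
    Σ< V (λ x → [ does (dist x y ≟ 0) ]· w x 0)
      ≡⟨ Σ<-cong V (λ x x<V → cong ([_]· w x 0) (does-⇔ (dist≡0⇔ x<V) (dist x y ≟ 0) (x ≟ y))) ⟩
    Σ< V (λ x → [ does (x ≟ y) ]· w x 0)
      ≡⟨ Σ<-delta V (λ x → w x 0) y<V ⟩
    w y 0 ∎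
    where
    open ≡-Reasoning
    open Σℤ
    dist≡0⇔ : ∀ {x} → x < V → dist x y ≡ 0 ⇔ x ≡ y
    dist≡0⇔ x<V = mk⇔ (λ dist≡0 → sym (dist≡0⇒ x<V y<V dist≡0)) (λ { refl → dist-self x<V })
  Σ-dist≡ w {y} {suc e} y<V d≤h = begin
    Σ< V (λ x → [ does (dist x y ≟ d) ]· w x d)
      ≡⟨ Σ<-cong V (λ x x<V → []·-⊎ (dist x y ≟ d) (x ≟ y ⊖ d) (x ≟ y ⊕ d)
                                    (dist≡⇔ x<V y<V d≤h) (disjoint x) (w x d)) ⟩
    Σ< V (λ x → [ does (x ≟ y ⊖ d) ]· w x d ℤ.+ [ does (x ≟ y ⊕ d) ]· w x d)
      ≡⟨ Σ<-distrib V (λ x → [ does (x ≟ y ⊖ d) ]· w x d) (λ x → [ does (x ≟ y ⊕ d) ]· w x d) ⟩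
    Σ< V (λ x → [ does (x ≟ y ⊖ d) ]· w x d) ℤ.+ Σ< V (λ x → [ does (x ≟ y ⊕ d) ]· w x d)
      ≡⟨ cong₂ ℤ._+_ (Σ<-delta V (λ x → w x d) (⊕<V y (V ∸ d)))
                     (Σ<-delta V (λ x → w x d) (⊕<V y d)) ⟩
    w (y ⊖ d) d ℤ.+ w (y ⊕ d) d ∎
    where
    open ≡-Reasoning
    open Σℤ
    d : ℕ
    d = suc e
    disjoint : ∀ x → ¬ (x ≡ y ⊖ d × x ≡ y ⊕ d)
    disjoint x (x≡⊖ , x≡⊕) = ⊕≢⊖ y (s≤s z≤n) d≤h (trans (sym x≡⊕) x≡⊖)

  valueAround : (ℕ → ℕ → ℤ) → ℕ → ℤ
  valueAround w k = Σℤ.Σ< V (λ x → Σℤ.Σ< (suc h) (λ d → Σℤ.[ does (k ∈ᴺ? B x d) ]· w x d))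

  valueAround-old : ∀ {n w k} → Balanced n w → k < V → valueAround w k ≡ 0ℤ
  valueAround-old {w = w} {k} bal k<V = begin
    Σ< V (λ x → Σ< (suc h) (λ d → [ does (k ∈ᴺ? B x d) ]· w x d))
      ≡⟨ Σ<-cong V (λ x x<V → Σ<-cong (suc h) (λ d _ → cong ([_]· w x d)
           (does-⇔ (⇔-trans (old∈B⇔ k<V x<V) (mk⇔ sym sym)) (k ∈ᴺ? B x d) (x ≟ k)))) ⟩
    Σ< V (λ x → Σ< (suc h) (λ d → [ does (x ≟ k) ]· w x d))
      ≡⟨ Σ<-cong V (λ x _ → Σ<-[]· (suc h) (does (x ≟ k)) (w x)) ⟩
    Σ< V (λ x → [ does (x ≟ k) ]· Σ< (suc h) (w x))
      ≡⟨ Σ<-delta V (λ x → Σ< (suc h) (w x)) k<V ⟩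
    Σ< (suc h) (w k)
      ≡⟨ Σ-old k<V ⟩
    0ℤ ∎
    where
    open ≡-Reasoning
    open Σℤ
    open Balanced bal

  valueAround-new : ∀ {n w y} → Balanced n w → y < V → valueAround w (V + y) ≡ 0ℤ
  valueAround-new {w = w} {y} bal y<V = begin
    Σ< V (λ x → Σ< (suc h) (λ d → [ does (V + y ∈ᴺ? B x d) ]· w x d))
      ≡⟨ Σ<-cong V (λ x x<V → Σ<-cong (suc h) (λ d d<1+h → cong ([_]· w x d)
           (does-⇔ (new∈B⇔ y<V x<V (ℕ.≤-pred d<1+h)) (V + y ∈ᴺ? B x d) (dist x y ≟ d)))) ⟩
    Σ< V (λ x → Σ< (suc h) (λ d → [ does (dist x y ≟ d) ]· w x d))
      ≡⟨ Σ<-swap V (suc h) (λ x d → [ does (dist x y ≟ d) ]· w x d) ⟩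
    Σ< (suc h) (λ d → Σ< V (λ x → [ does (dist x y ≟ d) ]· w x d))
      ≡⟨ Σ<-cong (suc h) (λ d d<1+h → Σ-dist≡ w y<V (ℕ.≤-pred d<1+h)) ⟩
    Σ< (suc h) (atNewPoint w y)
      ≡⟨ Σ-new y<V ⟩
    0ℤ ∎
    where
    open ≡-Reasoning
    open Σℤ
    open Balanced bal

  valueAround-∞ : ∀ {n w} → Balanced n w → valueAround w (V + V) ≡ 0ℤ
  valueAround-∞ {w = w} bal = begin
    Σ< V (λ x → Σ< (suc h) (λ d → [ does (V + V ∈ᴺ? B x d) ]· w x d))
      ≡⟨ Σ<-cong V (λ x x<V → Σ<-cong (suc h) (λ d d<1+h → cong ([_]· w x d)
           (does-⇔ (∞∈B⇔ x<V (ℕ.≤-pred d<1+h)) (V + V ∈ᴺ? B x d) (d ≟ 0)))) ⟩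
    Σ< V (λ x → Σ< (suc h) (λ d → [ does (d ≟ 0) ]· w x d))
      ≡⟨ Σ<-swap V (suc h) (λ x d → [ does (d ≟ 0) ]· w x d) ⟩
    Σ< (suc h) (λ d → Σ< V (λ x → [ does (d ≟ 0) ]· w x d))
      ≡⟨ Σ<-cong (suc h) (λ d _ → Σ<-[]· V (does (d ≟ 0)) (λ x → w x d)) ⟩
    Σ< (suc h) (λ d → [ does (d ≟ 0) ]· Σ< V (λ x → w x d))
      ≡⟨ Σ<-delta (suc h) (λ d → Σ< V (λ x → w x d)) (s≤s z≤n) ⟩
    Σ< V (λ x → w x 0)
      ≡⟨ Σ-∞ ⟩
    0ℤ ∎
    where
    open ≡-Reasoning
    open Σℤ
    open Balanced bal

  valueAround≡0 : ∀ {n w k} → Balanced n w → Point k → valueAround w k ≡ 0ℤ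
  valueAround≡0 bal (old k<V) = valueAround-old bal k<V
  valueAround≡0 bal (new y<V) = valueAround-new bal y<V
  valueAround≡0 bal ∞         = valueAround-∞ bal

  -- Old blocks are recognised by their largest point. On B x d the smallest point is x, and both
  -- other points are either new at distance d from x or ∞, which is the largest point.
  extendWith : (Triple V → ℤ) → (ℕ → ℕ → ℤ) → (t : Triple N) → Dec (toℕ (c t) < V) → ℤ
  extendWith f w t (yes c<V) = f (lower t c<V)
  extendWith f w t (no  _)   = w (toℕ (a t)) (dist (toℕ (a t)) (toℕ (b t) ∸ V))

  extend : (Triple V → ℤ) → (ℕ → ℕ → ℤ) → Triple N → ℤ
  extend f w t = extendWith f w t (toℕ (c t) ℕ.<? V)

  extend-lift : ∀ f w t → extend f w (lift t) ≡ f t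
  extend-lift f w t = begin
    extendWith f w (lift t) (toℕ (c (lift t)) ℕ.<? V)
      ≡⟨ cong (extendWith f w (lift t)) (dec-yes-irr (toℕ (c (lift t)) ℕ.<? V) ℕ.<-irrelevant c<V) ⟩
    f (lower (lift t) c<V)
      ≡⟨ cong f (lower-lift t c<V) ⟩
    f t ∎
    where
    open ≡-Reasoning
    c<V : toℕ (c (lift t)) < V
    c<V = subst (_< V) (sym (c-⟨⟩ (a<b t) (b<c t) _)) (Fin.toℕ<n (c t))

  extend-B : ∀ f w {x d} → x < V → d ≤ h → extend f w (B x d) ≡ w x d
  extend-B f w {x} {d} x<V d≤h = begin
    extendWith f w (B x d) (toℕ (c (B x d)) ℕ.<? V)
      ≡⟨ cong (extendWith f w (B x d)) (dec-no (toℕ (c (B x d)) ℕ.<? V) (ℕ.≤⇒≯ (V≤c-B x<V))) ⟩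
    w (toℕ (a (B x d))) (dist (toℕ (a (B x d))) (toℕ (b (B x d)) ∸ V))
      ≡⟨ cong (λ z → w z (dist z (toℕ (b (B x d)) ∸ V))) (a-B x<V) ⟩
    w x (dist x (toℕ (b (B x d)) ∸ V))
      ≡⟨ cong (w x) (dist-b-B x<V d≤h) ⟩
    w x d ∎
    where open ≡-Reasoning

  module _ (S : STS V) where

    oldBlocks : List (Triple N)
    oldBlocks = map lift (blocks S)

    count-oldBlocks : ∀ k₁ k₂ → pairCount k₁ k₂ oldBlocks ≡ pairCount k₁ k₂ (blocks S)
    count-oldBlocks k₁ k₂ = trans (Σℕ.sumWhere-map (bothIn k₁ k₂) (const 1) lift (blocks S))
      (Σℕ.sumWhere-cong (blocks S) (bothIn-lift k₁ k₂) (λ _ → refl))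

    count-S-old : ∀ {k₁ k₂} → k₁ < V → k₂ < V → k₁ ≢ k₂ → pairCount k₁ k₂ (blocks S) ≡ 1
    count-S-old {k₁} {k₂} k₁<V k₂<V k₁≢k₂ = begin
      pairCount k₁ k₂ (blocks S)
        ≡⟨ cong₂ (λ k₁ k₂ → pairCount k₁ k₂ (blocks S))
                 (Fin.toℕ-fromℕ< k₁<V) (Fin.toℕ-fromℕ< k₂<V) ⟨
      pairCount (toℕ u) (toℕ w) (blocks S)
        ≡⟨ count-hasPair u w (blocks S) ⟨
      length (filter (λ t → hasPair u w t Bool.≟ true) (blocks S))
        ≡⟨ steiner S u w (k₁≢k₂ ∘ toℕ≡) ⟩
      1 ∎
      where
      open ≡-Reasoning
      u w : Fin V
      u = fromℕ< k₁<V
      w = fromℕ< k₂<V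
      toℕ≡ : u ≡ w → k₁ ≡ k₂
      toℕ≡ u≡w = trans (sym (Fin.toℕ-fromℕ< k₁<V)) (trans (cong toℕ u≡w) (Fin.toℕ-fromℕ< k₂<V))

    count-S-¬old : ∀ {k₁ k₂} → ¬ (k₁ < V × k₂ < V) → pairCount k₁ k₂ (blocks S) ≡ 0
    count-S-¬old {k₁} {k₂} ¬old = Σℕ.sumWhere-none (bothIn k₁ k₂) (const 1) (blocks S)
      (λ t → dec-false (k₁ ∈ᴺ? t ×-dec k₂ ∈ᴺ? t)
                       (λ (k₁∈ , k₂∈) → ¬old (∈ᴺ⇒< t k₁∈ , ∈ᴺ⇒< t k₂∈)))

    steiner-doubled : ∀ (u w : Fin N) → u ≢ w →
                      length (filter (λ t → hasPair u w t Bool.≟ true) (oldBlocks ++ newBlocks)) ≡ 1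
    steiner-doubled u w u≢w = begin
      length (filter (λ t → hasPair u w t Bool.≟ true) (oldBlocks ++ newBlocks))
        ≡⟨ count-hasPair u w (oldBlocks ++ newBlocks) ⟩
      pairCount k₁ k₂ (oldBlocks ++ newBlocks)
        ≡⟨ Σℕ.sumWhere-++ (bothIn k₁ k₂) (const 1) oldBlocks newBlocks ⟩
      pairCount k₁ k₂ oldBlocks + pairCount k₁ k₂ newBlocks
        ≡⟨ cong (_+ pairCount k₁ k₂ newBlocks) (count-oldBlocks k₁ k₂) ⟩
      pairCount k₁ k₂ (blocks S) + pairCount k₁ k₂ newBlocks
        ≡⟨ by-cases (pair-view (point (Fin.toℕ<n u)) (point (Fin.toℕ<n w)) k₁≢k₂) ⟩
      1 ∎
      where
      open ≡-Reasoning
      k₁ k₂ : ℕ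
      k₁ = toℕ u
      k₂ = toℕ w
      k₁≢k₂ : k₁ ≢ k₂
      k₁≢k₂ = u≢w ∘ Fin.toℕ-injective
      by-cases : (k₁ < V × k₂ < V) ⊎ UniqueNewBlock k₁ k₂ →
                 pairCount k₁ k₂ (blocks S) + pairCount k₁ k₂ newBlocks ≡ 1
      by-cases (inj₁ (k₁<V , k₂<V)) =
        cong₂ _+_ (count-S-old k₁<V k₂<V k₁≢k₂) (count-newBlocks-old k₁<V k₂<V k₁≢k₂)
      by-cases (inj₂ unique) =
        cong₂ _+_ (count-S-¬old (UniqueNewBlock⇒¬old unique k₁≢k₂)) (count-newBlocks-unique unique)

    doubled : STS N
    doubled = sts (oldBlocks ++ newBlocks) steiner-doubled

    ι-∈-lift : ∀ i t → toℕ i ∈ᴺ t → ι i ∈ᵗ lift t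
    ι-∈-lift i t i∈t = trans (hasPt-∈ᴺ (ι i) (lift t))
      (dec-true (toℕ (ι i) ∈ᴺ? lift t)
                (Equivalence.from (∈ᴺ-lift t) (subst (_∈ᴺ t) (sym (toℕ-ι i)) i∈t)))

    doubled-embeds : EmbeddedIn S doubled
    doubled-embeds = ι , ι-injective , λ {t} t∈S →
      lift t , ∈-++⁺ˡ (∈-map⁺ lift t∈S) ,
      ι-∈-lift (a t) t (inj₁ refl) ,
      ι-∈-lift (b t) t (inj₂ (inj₁ refl)) ,
      ι-∈-lift (c t) t (inj₂ (inj₂ refl))

    Σ-oldBlocks : ∀ f w k → sumAt k (extend f w) oldBlocks ≡ sumAt k f (blocks S)
    Σ-oldBlocks f w k = trans (Σℤ.sumWhere-map (λ t → does (k ∈ᴺ? t)) (extend f w) lift (blocks S))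
      (Σℤ.sumWhere-cong (blocks S) (λ t → does-⇔ (∈ᴺ-lift t) (k ∈ᴺ? lift t) (k ∈ᴺ? t))
                        (extend-lift f w))

    Σ-blocks : ∀ {n} f → IsZeroSumFlow n S f → ∀ k → sumAt k f (blocks S) ≡ 0ℤ
    Σ-blocks f (_ , f-sum) k with k ℕ.<? V
    ... | yes k<V = begin
      sumAt k f (blocks S)                  ≡⟨ cong (λ k → sumAt k f (blocks S)) (Fin.toℕ-fromℕ< k<V) ⟨
      sumAt (toℕ u) f (blocks S)            ≡⟨ sum-hasPt u f (blocks S) ⟨
      Σℤ.sumWhere (hasPt u) f (blocks S)    ≡⟨ f-sum u ⟩
      0ℤ                                    ∎
      where
      open ≡-Reasoning
      u : Fin V
      u = fromℕ< k<V
    ... | no  k≮V = Σℤ.sumWhere-none (λ t → does (k ∈ᴺ? t)) f (blocks S)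
                      (λ t → dec-false (k ∈ᴺ? t) (k≮V ∘ ∈ᴺ⇒< t))

    Σ-newBlocks : ∀ {n} f w → Balanced n w → ∀ {k} → Point k → sumAt k (extend f w) newBlocks ≡ 0ℤ
    Σ-newBlocks f w bal {k} p = begin
      sumAt k (extend f w) newBlocks
        ≡⟨ Σℤ.sumWhere-grid (λ t → does (k ∈ᴺ? t)) (extend f w) B V (suc h) ⟩
      Σ< V (λ x → Σ< (suc h) (λ d → [ does (k ∈ᴺ? B x d) ]· extend f w (B x d)))
        ≡⟨ Σ<-cong V (λ x x<V → Σ<-cong (suc h) (λ d d<1+h →
             cong ([ does (k ∈ᴺ? B x d) ]·_) (extend-B f w x<V (ℕ.≤-pred d<1+h)))) ⟩
      valueAround w k
        ≡⟨ valueAround≡0 bal p ⟩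
      0ℤ ∎
      where
      open ≡-Reasoning
      open Σℤ

    doubled-admissible : ∀ {n f w} → Balanced n w → IsZeroSumFlow n S f →
                         ∀ {t} → t ∈ oldBlocks ++ newBlocks → Admissible n (extend f w t)
    doubled-admissible {n} {f} {w} bal (f-admissible , _) t∈ with ∈-++⁻ oldBlocks t∈
    ... | inj₁ t∈old = let s , s∈S , t≡ = ∈-map⁻ lift t∈old in
      subst (Admissible n) (sym (trans (cong (extend f w) t≡) (extend-lift f w s))) (f-admissible s∈S)
    ... | inj₂ t∈new = let x , d , x<V , d≤h , t≡ = ∈-newBlocks⁻ t∈new in
      subst (Admissible n) (sym (trans (cong (extend f w) t≡) (extend-B f w x<V d≤h)))
        (Balanced.admissible bal x d)

    doubled-Σ≡0 : ∀ {n f w} → Balanced n w → IsZeroSumFlow n S f →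
                  ∀ u → sumℤ (map (extend f w) (blocksAt doubled u)) ≡ 0ℤ
    doubled-Σ≡0 {f = f} {w} bal flow u = begin
      Σℤ.sumWhere (hasPt u) (extend f w) (oldBlocks ++ newBlocks)
        ≡⟨ sum-hasPt u (extend f w) (oldBlocks ++ newBlocks) ⟩
      sumAt k (extend f w) (oldBlocks ++ newBlocks)
        ≡⟨ Σℤ.sumWhere-++ (λ t → does (k ∈ᴺ? t)) (extend f w) oldBlocks newBlocks ⟩
      sumAt k (extend f w) oldBlocks
        ℤ.+ sumAt k (extend f w) newBlocks
        ≡⟨ cong₂ ℤ._+_ (trans (Σ-oldBlocks f w k) (Σ-blocks f flow k))
                       (Σ-newBlocks f w bal (point (Fin.toℕ<n u))) ⟩
      0ℤ ∎
      where
      open ≡-Reasoning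
      k : ℕ
      k = toℕ u

    doubled-flow : ∀ {n f w} → Balanced n w → IsZeroSumFlow n S f → IsZeroSumFlow n doubled (extend f w)
    doubled-flow bal flow = doubled-admissible bal flow , doubled-Σ≡0 bal flow

-- Flow values on the new blocks: the value of B(x, d) depends on d and on whether 3 divides x.
--   d     :  0   1   2   3   4 | 5   6   7  ...
--   3 ∣ x : -2   1   1   1  -1 | 1   1  -2  (period 3 from d = 5 on)
--   3 ∤ x :  1   1   1  -1  -2 | 1   1  -2
module Labels where

  open Σℤ
  open import Data.Integer using (+_; -_)
  open ≡-Reasoning

  cycle : ℕ → ℤ
  cycle 0 = + 1
  cycle 1 = + 1
  cycle 2 = - + 2
  cycle (suc (suc (suc k))) = cycle k

  ifZero : ℕ → ℤ → ℤ → ℤ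
  ifZero zero    z _ = z
  ifZero (suc _) _ z = z

  label : ℕ → ℕ → ℤ
  label r 0 = ifZero r (- + 2) (+ 1)
  label r 1 = + 1
  label r 2 = + 1
  label r 3 = ifZero r (+ 1) (- + 1)
  label r 4 = ifZero r (- + 1) (- + 2)
  label r (suc (suc (suc (suc (suc k))))) = cycle k

  flowValue : ℕ → ℕ → ℤ
  flowValue x d = label (x % 3) d

  +1-admissible : Admissible 4 (+ 1)
  +1-admissible = (λ ()) , s≤s (s≤s z≤n)

  -1-admissible : Admissible 4 (- + 1)
  -1-admissible = (λ ()) , s≤s (s≤s z≤n)

  -2-admissible : Admissible 4 (- + 2)
  -2-admissible = (λ ()) , s≤s (s≤s (s≤s z≤n))

  cycle-admissible : ∀ k → Admissible 4 (cycle k)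
  cycle-admissible 0 = +1-admissible
  cycle-admissible 1 = +1-admissible
  cycle-admissible 2 = -2-admissible
  cycle-admissible (suc (suc (suc k))) = cycle-admissible k

  label-admissible : ∀ r d → Admissible 4 (label r d)
  label-admissible zero    0 = -2-admissible
  label-admissible (suc r) 0 = +1-admissible
  label-admissible r       1 = +1-admissible
  label-admissible r       2 = +1-admissible
  label-admissible zero    3 = +1-admissible
  label-admissible (suc r) 3 = -1-admissible
  label-admissible zero    4 = -1-admissible
  label-admissible (suc r) 4 = -2-admissible
  label-admissible r (suc (suc (suc (suc (suc k))))) = cycle-admissible k

  Σ-label : ∀ m r → Σ< (5 + m * 3) (label r) ≡ 0ℤ
  Σ-label m r = begin
    Σ< (5 + m * 3) (label r)            ≡⟨ Σ<-split 5 (m * 3) (label r) ⟩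
    Σ< (m * 3) cycle ℤ.+ Σ< 5 (label r) ≡⟨ cong₂ ℤ._+_ (Σ<-periodic 3 m cycle (λ _ → refl) refl) (head r) ⟩
    0ℤ                                  ∎
    where
    head : ∀ r → Σ< 5 (label r) ≡ 0ℤ
    head zero    = refl
    head (suc r) = refl

  Σ-flowValue-0 : ∀ k → Σ< (k * 3) (λ x → flowValue x 0) ≡ 0ℤ
  Σ-flowValue-0 k = Σ<-periodic 3 k (λ x → flowValue x 0)
    (λ j → cong (λ r → label r 0) (%-remove-+ˡ j (∣-refl {3}))) refl

  newPointValue : ℕ → ℕ → ℤ
  newPointValue y zero    = flowValue y 0
  newPointValue y (suc e) = flowValue (y + (suc e + suc e)) (suc e) ℤ.+ flowValue (y + suc e) (suc e)

  Σ-newPointValue : ∀ m y → Σ< (5 + m * 3) (newPointValue y) ≡ 0ℤ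
  Σ-newPointValue m y = begin
    Σ< (5 + m * 3) (newPointValue y)
      ≡⟨ Σ<-split 5 (m * 3) (newPointValue y) ⟩
    Σ< (m * 3) (λ k → cycle k ℤ.+ cycle k) ℤ.+ Σ< 5 (newPointValue y)
      ≡⟨ cong₂ ℤ._+_ (Σ<-periodic 3 m (λ k → cycle k ℤ.+ cycle k) (λ _ → refl) refl)
                     (trans (Σ<-cong 5 (λ d _ → residue d)) (head (m%n<n y 3))) ⟩
    0ℤ ∎
    where
    %3-+ : ∀ c → (y + c) % 3 ≡ (y % 3 + c) % 3
    %3-+ c = begin
      (y + c) % 3               ≡⟨ %-distribˡ-+ y c 3 ⟩
      (y % 3 + c % 3) % 3       ≡⟨ cong (λ r → (r + c % 3) % 3) (m%n%n≡m%n y 3) ⟨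
      (y % 3 % 3 + c % 3) % 3   ≡⟨ %-distribˡ-+ (y % 3) c 3 ⟨
      (y % 3 + c) % 3           ∎
    residue : ∀ d → newPointValue y d ≡ newPointValue (y % 3) d
    residue zero    = cong (λ r → label r 0) (sym (m%n%n≡m%n y 3))
    residue (suc e) = cong₂ ℤ._+_ (cong (λ r → label r (suc e)) (%3-+ _))
                                  (cong (λ r → label r (suc e)) (%3-+ _))
    head : ∀ {r} → r < 3 → Σ< 5 (newPointValue r) ≡ 0ℤ
    head {0} _ = refl
    head {1} _ = refl
    head {2} _ = refl
    head {suc (suc (suc _))} (s≤s (s≤s (s≤s ())))

-- The case V = 9 + 6m

module _ (m : ℕ) where

  open Doubling (4 + m * 3)
  open Labels

  flowValue-balanced : Balanced 4 flowValue
  flowValue-balanced = record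
    { admissible = λ x d → label-admissible (x % 3) d
    ; Σ-old      = λ {x} _ → Σ-label m (x % 3)
    ; Σ-∞        = subst (λ n → Σℤ.Σ< n (λ x → flowValue x 0) ≡ 0ℤ) (sym V≡[3+2m]*3)
                         (Σ-flowValue-0 (3 + m * 2))
    ; Σ-new      = λ {y} _ → trans (Σℤ.Σ<-cong (suc h) (λ d d<1+h → as-newPointValue y (ℕ.≤-pred d<1+h)))
                                   (Σ-newPointValue m y)
    }
    where
    h : ℕ
    h = 4 + m * 3
    V≡[3+2m]*3 : V ≡ (3 + m * 2) * 3
    V≡[3+2m]*3 = 9+6m≡[3+2m]*3 m
      where
      9+6m≡[3+2m]*3 : ∀ m → suc ((4 + m * 3) + (4 + m * 3)) ≡ (3 + m * 2) * 3
      9+6m≡[3+2m]*3 = solve-∀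
    3∣V : 3 ∣ V
    3∣V = divides (3 + m * 2) V≡[3+2m]*3
    as-newPointValue : ∀ y {d} → d ≤ h → atNewPoint flowValue y d ≡ newPointValue y d
    as-newPointValue y {zero}  _   = refl
    as-newPointValue y {suc e} d≤h = cong₂ ℤ._+_
      (cong (λ r → label r (suc e)) (⊖-mod-3 3∣V y (ℕ.<⇒≤ (≤h⇒<V d≤h))))
      (cong (λ r → label r (suc e)) (⊕-mod-3 3∣V y (suc e)))

  doubling-with-flow : (S : STS V) → HasZeroSumFlow 4 S →
                       Σ (STS (2 * V + 1)) (λ T → HasZeroSumFlow 4 T × EmbeddedIn S T)
  doubling-with-flow S (f , flow) =
    doubled S , (extend f flowValue , doubled-flow S flowValue-balanced flow) , doubled-embeds S

v%6≡3⇒v≡9+6m : ∀ {v} → v % 6 ≡ 3 → 9 < v → ∃ λ m → v ≡ suc ((4 + m * 3) + (4 + m * 3))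
v%6≡3⇒v≡9+6m {v} v%6≡3 9<v with v / 6 | trans (m≡m%n+[m/n]*n v 6) (cong (_+ (v / 6) * 6) v%6≡3)
... | zero  | v≡3 = ⊥-elim (ℕ.<⇒≢ (ℕ.<-trans (s≤s (s≤s (s≤s (s≤s z≤n)))) 9<v) (sym v≡3))
... | suc m | v≡  = m , trans v≡ (3+6[1+m]≡9+6m m)
  where
  3+6[1+m]≡9+6m : ∀ m → 3 + suc m * 6 ≡ suc ((4 + m * 3) + (4 + m * 3))
  3+6[1+m]≡9+6m = solve-∀

mainTheorem6 : ∀ (v : ℕ) → v % 6 ≡ 3 → 9 < v → (S : STS v) → HasZeroSumFlow 4 S →
                 Σ (STS (2 * v + 1)) (λ T → HasZeroSumFlow 4 T × EmbeddedIn S T)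
mainTheorem6 v v%6≡3 9<v with v%6≡3⇒v≡9+6m v%6≡3 9<v
... | m , refl = doubling-with-flow m
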